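{- Let $n\ge 2$ and let $\mathcal{A}_n$ denote the set of arc permutations in $S_n$. Then $$\sum_{\pi\in\mathcal{A}_n} q^{\mathrm{maj}(\pi)}=[n]_q \prod_{i=1}^{n-2} (1+q^{i}),\qquad \sum_{\pi\in \mathcal{A}_n} \mathrm{sign}(\pi) q^{\mathrm{maj}(\pi)}= [n]_{(-1)^{n-1}q} \prod_{i=1}^{n-2} (1+ (-q)^i).$$
   Context: An interval of $\mathbb{Z}_n$ is a set of the form $\{a,a+1,\dots,b\}$ or $\{b,b+1,\dots,n,1,2,\dots,a\}$ with $1\le a\le b\le n$. A permutation $\pi\in S_n$ is an arc permutation if for every $1\le j\le n$ the set $\{\pi(1),\dots,\pi(j)\}$ is an interval of $\mathbb{Z}_n$. For $\pi\in S_n$, $\mathrm{maj}(\pi)=\sum_{i:\pi(i)>\pi(i+1)}i$, $\mathrm{sign}(\pi)=(-1)^{\mathrm{inv}(\pi)}$ where $\mathrm{inv}(\pi)=\#\{i<j:\pi(i)>\pi(j)\}$. $[m]_q=1+q+\dots+q^{m-1}$ (so $[m]_{z}=1+z+\dots+z^{m-1}$ for any $z$). -}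

module Defs where

open import Data.Nat as ℕ using (ℕ; zero; suc; _≤ᵇ_; _<ᵇ_; _≡ᵇ_)
open import Data.Bool using (Bool; true; false; _∧_; _∨_; not; if_then_else_)
open import Data.List using (List; []; _∷_; _++_; map; concatMap; filter; length; foldr; upTo; applyUpTo; take)
open import Data.Integer as ℤ using (ℤ; +_; -_)
open import Relation.Nullary.Decidable using (yes; no)
open import Data.Bool.Properties using () renaming (T? to T?)
open import Data.Bool using (T)

-- Permutations of [n] = {1,…,n} are represented in one-line notation
-- as lists [π(1), …, π(n)] of naturals.

range : ℕ → ℕ → List ℕ
range a b = applyUpTo (λ k → a ℕ.+ k) (suc b ℕ.∸ a)

words : ℕ → ℕ → List (List ℕ)
words n zero    = [] ∷ []
words n (suc k) = concatMap (λ x → map (x ∷_) (words n k)) (range 1 n)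

elemᵇ : ℕ → List ℕ → Bool
elemᵇ x []       = false
elemᵇ x (y ∷ ys) = (x ≡ᵇ y) ∨ elemᵇ x ys

allᵇ : {A : Set} → (A → Bool) → List A → Bool
allᵇ p []       = true
allᵇ p (x ∷ xs) = p x ∧ allᵇ p xs

anyᵇ : {A : Set} → (A → Bool) → List A → Bool
anyᵇ p []       = false
anyᵇ p (x ∷ xs) = p x ∨ anyᵇ p xs

distinctᵇ : List ℕ → Bool
distinctᵇ []       = true
distinctᵇ (x ∷ xs) = not (elemᵇ x xs) ∧ distinctᵇ xs

Sym : ℕ → List (List ℕ)
Sym n = filter (λ w → T? (distinctᵇ w)) (words n n)

sameSetᵇ : List ℕ → List ℕ → Bool
sameSetᵇ xs ys = allᵇ (λ x → elemᵇ x ys) xs ∧ allᵇ (λ y → elemᵇ y xs) ys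

-- S is an interval of ℤ_n: S = {a,…,b} or S = {b,…,n,1,…,a} with 1 ≤ a ≤ b ≤ n
isIntervalᵇ : ℕ → List ℕ → Bool
isIntervalᵇ n S =
  anyᵇ (λ a → anyᵇ (λ b →
          (a ≤ᵇ b) ∧ (sameSetᵇ S (range a b) ∨ sameSetᵇ S (range b n ++ range 1 a)))
        (range 1 n)) (range 1 n)

isArcᵇ : ℕ → List ℕ → Bool
isArcᵇ n π = allᵇ (λ j → isIntervalᵇ n (take j π)) (range 1 n)

Arc : ℕ → List (List ℕ)
Arc n = filter (λ π → T? (isArcᵇ n π)) (Sym n)

-- maj(π) = Σ_{i : π(i) > π(i+1)} i   (positions 1-based)
majFrom : ℕ → List ℕ → ℕ
majFrom i []           = 0
majFrom i (x ∷ [])     = 0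
majFrom i (x ∷ y ∷ ys) = (if y <ᵇ x then i else 0) ℕ.+ majFrom (suc i) (y ∷ ys)

maj : List ℕ → ℕ
maj = majFrom 1

inv : List ℕ → ℕ
inv []       = 0
inv (x ∷ xs) = length (filter (λ y → T? (y <ᵇ x)) xs) ℕ.+ inv xs

sign : List ℕ → ℤ
sign π = (ℤ.- (+ 1)) ℤ.^ inv π

sumℤ : List ℤ → ℤ
sumℤ = foldr ℤ._+_ (+ 0)

qint : ℕ → ℤ → ℤ
qint m z = sumℤ (applyUpTo (λ k → z ℤ.^ k) m)

prodFrom1 : ℕ → (ℕ → ℤ) → ℤ
prodFrom1 m f = foldr ℤ._*_ (+ 1) (map f (range 1 m))

module Submission where

-- Let ρ be the rotation x ↦ x + 1 of ℤ_n.  Relabelling by ρ maps cyclic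
-- intervals to cyclic intervals, hence arc permutations to arc permutations, and
-- it sends those ending in v < n bijectively onto those ending in v + 1.  On a
-- permutation not ending in n it lowers maj by one and changes inv by n - 1
-- modulo 2.  So for the weight W = q^maj (resp. sign · q^maj) and the ratio
-- z = q (resp. (-1)^(n-1) q), the arc permutations ending in n - i weigh z^i
-- times those ending in n, and grouping by the last letter gives
--   Σ_{𝒜_n} W = [n]_z · Σ_{π ∈ 𝒜_n ending in n} W(π).
-- An arc permutation ending in n is σ n with σ a linear arc permutation of
-- [1,n-1] (all prefixes are ordinary intervals).  Its last letter is 1 or n - 1,
-- so σ = lin c for a unique boolean word c of length n - 2; appending a
-- new minimum after i letters adds a descent at i and i inversions, appending a
-- new maximum adds neither, and the sum over codes is the product above.

module Sums where

  open import Defs using (sumℤ)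
  open import Data.Integer using (ℤ; +_; _+_; _*_)
  open import Data.Integer.Properties
    using ( +-assoc; +-identityˡ; +-identityʳ; *-zeroˡ; *-zeroʳ; *-distribˡ-+; *-distribʳ-+
          ; +-0-isCommutativeMonoid; +-commutativeSemigroup )
  open import Algebra.Properties.CommutativeSemigroup +-commutativeSemigroup using () renaming (interchange to +-interchange)
  open import Data.Bool using (if_then_else_)
  open import Data.List using (List; []; _∷_; _++_; map; filter)
  open import Data.List.Properties using (map-∘)
  open import Data.List.Membership.Propositional using (_∈_; _∉_)
  open import Data.List.Membership.Propositional.Properties using (∈-map⁺; ∈-map⁻)
  open import Data.List.Membership.Propositional.Properties.WithK using (unique∧set⇒bag)
  open import Data.List.Relation.Unary.Any using (here; there)
  import Data.List.Relation.Unary.All as All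
  import Data.List.Relation.Unary.All.Properties as All
  open import Data.List.Relation.Unary.AllPairs using ([]; _∷_)
  open import Data.List.Relation.Unary.Unique.Propositional using (Unique)
  open import Data.List.Relation.Binary.BagAndSetEquality using (∼bag⇒↭)
  open import Data.List.Relation.Binary.Permutation.Propositional using (_↭_; ↭-sym; ↭⇒↭ₛ)
  import Data.List.Relation.Binary.Permutation.Propositional.Properties as ↭
  open import Data.List.Relation.Binary.Permutation.Setoid.Properties using (foldr-commMonoid)
  open import Data.Product using (∃; _×_; _,_)
  open import Function using (_∘_)
  open import Function.Bundles using (mk⇔)
  open import Relation.Binary.Definitions using (DecidableEquality)
  open import Relation.Binary.PropositionalEquality
  open import Relation.Nullary using (yes; no; does)
  open import Data.Empty using (⊥-elim)

  open ≡-Reasoning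

  sumℤ-++ : ∀ xs ys → sumℤ (xs ++ ys) ≡ sumℤ xs + sumℤ ys
  sumℤ-++ []       ys = sym (+-identityˡ _)
  sumℤ-++ (x ∷ xs) ys = trans (cong (_+_ x) (sumℤ-++ xs ys)) (sym (+-assoc x _ _))

  sumℤ-↭ : ∀ {xs ys} → xs ↭ ys → sumℤ xs ≡ sumℤ ys
  sumℤ-↭ = foldr-commMonoid (setoid ℤ) +-0-isCommutativeMonoid ∘ ↭⇒↭ₛ

  module _ {A : Set} where

    sumℤ-cong : ∀ (xs : List A) {F G : A → ℤ} → (∀ {x} → x ∈ xs → F x ≡ G x) →
                sumℤ (map F xs) ≡ sumℤ (map G xs)
    sumℤ-cong []       _   = refl
    sumℤ-cong (x ∷ xs) F≡G = cong₂ _+_ (F≡G (here refl)) (sumℤ-cong xs (F≡G ∘ there))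

    sumℤ-scaleˡ : ∀ (xs : List A) c (F : A → ℤ) → sumℤ (map (λ x → c * F x) xs) ≡ c * sumℤ (map F xs)
    sumℤ-scaleˡ []       c F = sym (*-zeroʳ c)
    sumℤ-scaleˡ (x ∷ xs) c F = trans (cong (_+_ (c * F x)) (sumℤ-scaleˡ xs c F)) (sym (*-distribˡ-+ c (F x) _))

    sumℤ-scaleʳ : ∀ (xs : List A) c (F : A → ℤ) → sumℤ (map (λ x → F x * c) xs) ≡ sumℤ (map F xs) * c
    sumℤ-scaleʳ []       c F = sym (*-zeroˡ c)
    sumℤ-scaleʳ (x ∷ xs) c F = trans (cong (_+_ (F x * c)) (sumℤ-scaleʳ xs c F)) (sym (*-distribʳ-+ c (F x) _))

    sumℤ-+ : ∀ (xs : List A) (F G : A → ℤ) → sumℤ (map (λ x → F x + G x) xs) ≡ sumℤ (map F xs) + sumℤ (map G xs)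
    sumℤ-+ []       F G = refl
    sumℤ-+ (x ∷ xs) F G = trans (cong (_+_ (F x + G x)) (sumℤ-+ xs F G))
                                (+-interchange (F x) (G x) (sumℤ (map F xs)) (sumℤ (map G xs)))

    sumℤ-zero : ∀ (xs : List A) → sumℤ (map (λ _ → + 0) xs) ≡ + 0
    sumℤ-zero []       = refl
    sumℤ-zero (x ∷ xs) = trans (+-identityˡ _) (sumℤ-zero xs)

  map-unique-on : ∀ {A B : Set} (g : A → B) {xs} → (∀ {x x′} → x ∈ xs → x′ ∈ xs → g x ≡ g x′ → x ≡ x′) →
                  Unique xs → Unique (map g xs)
  map-unique-on g {[]}     _         _          = []
  map-unique-on g {x ∷ xs} injective (x∉ ∷ xs!) =
    All.map⁺ (All.tabulate (λ x′∈ gx≡gx′ → All.lookup x∉ x′∈ (injective (here refl) (there x′∈) gx≡gx′)))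
    ∷ map-unique-on g (λ x∈ x′∈ → injective (there x∈) (there x′∈)) xs!

  sumℤ-reindex : ∀ {A B : Set} (xs : List A) (ys : List B) (g : A → B) (F : B → ℤ) →
                 Unique xs → Unique ys →
                 (∀ {x x′} → x ∈ xs → x′ ∈ xs → g x ≡ g x′ → x ≡ x′) →
                 (∀ {x} → x ∈ xs → g x ∈ ys) →
                 (∀ {y} → y ∈ ys → ∃ λ x → x ∈ xs × g x ≡ y) →
                 sumℤ (map F ys) ≡ sumℤ (map (F ∘ g) xs)
  sumℤ-reindex xs ys g F xs! ys! injective into onto = begin
    sumℤ (map F ys)          ≡⟨ sumℤ-↭ (↭.map⁺ F (↭-sym g[xs]↭ys)) ⟩
    sumℤ (map F (map g xs))  ≡⟨ cong sumℤ (sym (map-∘ xs)) ⟩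
    sumℤ (map (F ∘ g) xs)    ∎
    where
    g[xs]↭ys : map g xs ↭ ys
    g[xs]↭ys = ∼bag⇒↭ (unique∧set⇒bag (map-unique-on g injective xs!) ys! (mk⇔
      (λ y∈ → let x , x∈ , eq = ∈-map⁻ g y∈ in subst (_∈ ys) (sym eq) (into x∈))
      (λ y∈ → let x , x∈ , eq = onto y∈ in subst (_∈ map g xs) eq (∈-map⁺ g x∈))))

  module _ {A B : Set} (_≟_ : DecidableEquality B) (key : A → B) where

    Part : List A → B → List A
    Part xs v = filter (λ x → key x ≟ v) xs

    sumℤ-Part-∷ : ∀ (F : A → ℤ) x xs v →
                  sumℤ (map F (Part (x ∷ xs) v)) ≡ (if does (key x ≟ v) then F x else + 0) + sumℤ (map F (Part xs v))
    sumℤ-Part-∷ F x xs v with key x ≟ v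
    ... | yes _ = refl
    ... | no _  = sym (+-identityˡ _)

    sumℤ-indicator-∉ : ∀ u c vs → u ∉ vs → sumℤ (map (λ v → if does (u ≟ v) then c else + 0) vs) ≡ + 0
    sumℤ-indicator-∉ u c []       _  = refl
    sumℤ-indicator-∉ u c (v ∷ vs) u∉ with u ≟ v
    ... | yes u≡v = ⊥-elim (u∉ (here u≡v))
    ... | no _    = trans (+-identityˡ _) (sumℤ-indicator-∉ u c vs (u∉ ∘ there))

    sumℤ-indicator : ∀ u c vs → Unique vs → u ∈ vs → sumℤ (map (λ v → if does (u ≟ v) then c else + 0) vs) ≡ c
    sumℤ-indicator u c (v ∷ vs) (v∉ ∷ vs!) u∈ with u ≟ v | u∈
    ... | yes refl | _         = trans (cong (_+_ c) (sumℤ-indicator-∉ u c vs (All.All¬⇒¬Any v∉))) (+-identityʳ c)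
    ... | no u≢v   | here u≡v  = ⊥-elim (u≢v u≡v)
    ... | no _     | there u∈′ = trans (+-identityˡ _) (sumℤ-indicator u c vs vs! u∈′)

    sumℤ-partition : ∀ (F : A → ℤ) xs vs → Unique vs → (∀ {x} → x ∈ xs → key x ∈ vs) →
                     sumℤ (map F xs) ≡ sumℤ (map (λ v → sumℤ (map F (Part xs v))) vs)
    sumℤ-partition F []       vs _   _    = sym (sumℤ-zero vs)
    sumℤ-partition F (x ∷ xs) vs vs! keys = begin
      F x + sumℤ (map F xs)
        ≡⟨ cong₂ _+_ (sym (sumℤ-indicator (key x) (F x) vs vs! (keys (here refl))))
                     (sumℤ-partition F xs vs vs! (keys ∘ there)) ⟩
      sumℤ (map (λ v → if does (key x ≟ v) then F x else + 0) vs) + sumℤ (map (λ v → sumℤ (map F (Part xs v))) vs)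
        ≡⟨ sym (sumℤ-+ vs _ _) ⟩
      sumℤ (map (λ v → (if does (key x ≟ v) then F x else + 0) + sumℤ (map F (Part xs v))) vs)
        ≡⟨ sumℤ-cong vs (λ {v} _ → sym (sumℤ-Part-∷ F x xs v)) ⟩
      sumℤ (map (λ v → sumℤ (map F (Part (x ∷ xs) v))) vs) ∎


module ArcPermutations where

  open import Defs
  open import Data.Nat as ℕ using (ℕ; zero; suc; pred; _+_; _∸_; _≤_; _<_; z≤n; s≤s; _≟_; _<ᵇ_)
  open import Data.Nat.Properties
  open import Data.Nat.Tactic.RingSolver using (solve-∀)
  open import Data.Bool using (Bool; true; false; T; not; if_then_else_)
  open import Data.Bool.Properties using (T-∧; T-∨; T?)
  open import Data.List using ( List; []; _∷_; _++_; [_]; map; length; take; filter; last; concatMap; cartesianProductWith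
                              ; initLast; _∷ʳ′_ )
  open import Data.Maybe using (just)
  open import Data.List.Properties
    using ( length-++; length-applyUpTo; length-map; take-map; take-all; ∷-injective; filter-++; map-++
          ; map-injective; ∷ʳ-injectiveˡ; ∷ʳ-injectiveʳ )
  open import Data.List.Membership.Propositional using (_∈_; _∉_)
  open import Data.List.Membership.Propositional.Properties
    using ( ∈-applyUpTo⁺; ∈-applyUpTo⁻; ∈-++⁺ˡ; ∈-++⁺ʳ; ∈-++⁻; ∈-∃++; ∈-map⁺; ∈-map⁻
          ; ∈-filter⁺; ∈-filter⁻; ∈-cartesianProductWith⁺; ∈-cartesianProductWith⁻)
  open import Data.List.Relation.Unary.Any using (here; there; any?)
  open import Data.List.Relation.Unary.All.Properties using (¬Any⇒All¬; All¬⇒¬Any; ++⁻ˡ; ∷ʳ⁺)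
  open import Data.List.Relation.Unary.All using ([]) renaming (lookup to All-lookup)
  open import Data.List.Relation.Unary.AllPairs using ([]; _∷_)
  open import Data.List.Relation.Unary.Unique.Propositional using (Unique)
  import Data.List.Relation.Unary.Unique.Propositional.Properties as Unique
  import Data.List.Relation.Unary.Unique.Setoid.Properties as UniqueS
  open import Data.Product using (∃; ∃₂; _×_; _,_; proj₁; proj₂)
  open import Data.Sum using (_⊎_; inj₁; inj₂)
  open import Data.Empty using (⊥; ⊥-elim)
  open import Data.Unit using (tt)
  open import Function using (_∘_)
  open import Function.Bundles using (Equivalence; _⇔_; mk⇔)
  import Function.Properties.Equivalence as ⇔
  open import Relation.Binary.PropositionalEquality hiding ([_])
  open import Relation.Nullary using (¬_; yes; no)

  open Equivalence using (to; from)

  Bounded : ℕ → List ℕ → Set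
  Bounded n xs = ∀ {x} → x ∈ xs → 1 ≤ x × x ≤ n

  ∈-range⁺ : ∀ {a b x} → a ≤ x → x ≤ b → x ∈ range a b
  ∈-range⁺ {a} {b} a≤x x≤b = subst (_∈ range a b) (m+[n∸m]≡n a≤x)
    (∈-applyUpTo⁺ (a +_) (∸-monoˡ-< (s≤s x≤b) a≤x))

  ∈-range⁻ : ∀ {a b x} → x ∈ range a b → a ≤ x × x ≤ b
  ∈-range⁻ {a} {b} x∈ with ∈-applyUpTo⁻ (a +_) x∈
  ... | i , i<len , refl = m≤m+n a i , ≤-pred (offset a (suc b) i<len)
    where
    offset : ∀ a m {i} → i < m ∸ a → a + i < m
    offset zero    m       i<       = i<
    offset (suc a) (suc m) i<       = s≤s (offset a m i<)

  range-unique : ∀ a b → Unique (range a b)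
  range-unique a b = Unique.applyUpTo⁺₁ (a +_) (suc b ∸ a)
    (λ i<j _ eq → <-irrefl (+-cancelˡ-≡ a _ _ eq) i<j)

  unique⇒length≤ : ∀ {A : Set} {xs ys : List A} → Unique xs →
                   (∀ {x} → x ∈ xs → x ∈ ys) → length xs ≤ length ys
  unique⇒length≤ {xs = []} _ _ = z≤n
  unique⇒length≤ {xs = x ∷ xs} (x∉xs ∷ u) xs⊆ys with ∈-∃++ (xs⊆ys (here refl))
  ... | ys₁ , ys₂ , refl = begin
    suc (length xs)                   ≤⟨ s≤s (unique⇒length≤ u (λ y∈ → drop (xs⊆ys (there y∈)) y∈)) ⟩
    suc (length (ys₁ ++ ys₂))         ≡⟨ cong suc (length-++ ys₁) ⟩
    suc (length ys₁ + length ys₂)     ≡⟨ sym (+-suc (length ys₁) (length ys₂)) ⟩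
    length ys₁ + length (x ∷ ys₂)     ≡⟨ sym (length-++ ys₁) ⟩
    length (ys₁ ++ x ∷ ys₂)           ∎
    where
    open ≤-Reasoning
    -- an element of xs is different from x, so it survives deleting x from ys
    drop : ∀ {y} → y ∈ ys₁ ++ x ∷ ys₂ → y ∈ xs → y ∈ ys₁ ++ ys₂
    drop {y} y∈ys y∈xs with ∈-++⁻ ys₁ y∈ys
    ... | inj₁ y∈ys₁         = ∈-++⁺ˡ y∈ys₁
    ... | inj₂ (here refl)   = ⊥-elim (All¬⇒¬Any x∉xs y∈xs)
    ... | inj₂ (there y∈ys₂) = ∈-++⁺ʳ ys₁ y∈ys₂

  ∈-take : ∀ {A : Set} j (xs : List A) {x} → x ∈ take j xs → x ∈ xs
  ∈-take (suc j) (y ∷ ys) (here refl) = here refl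
  ∈-take (suc j) (y ∷ ys) (there x∈)  = there (∈-take j ys x∈)

  take-++ˡ : ∀ {A : Set} j (xs ys : List A) → j ≤ length xs → take j (xs ++ ys) ≡ take j xs
  take-++ˡ zero    xs       ys _         = refl
  take-++ˡ (suc j) (x ∷ xs) ys (s≤s j≤n) = cong (x ∷_) (take-++ˡ j xs ys j≤n)

  ∈-∷ʳ⁻ : ∀ {A : Set} (xs : List A) {x y} → x ∈ xs ++ [ y ] → x ∈ xs ⊎ x ≡ y
  ∈-∷ʳ⁻ xs x∈ with ∈-++⁻ xs x∈
  ... | inj₁ x∈xs      = inj₁ x∈xs
  ... | inj₂ (here eq) = inj₂ eq

  unique-middle : ∀ {A : Set} α {y : A} β → Unique (α ++ y ∷ β) → y ∉ α × y ∉ β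
  unique-middle []      β (y∉β ∷ _) = (λ ()) , All¬⇒¬Any y∉β
  unique-middle (x ∷ α) β (x∉ ∷ u) with unique-middle α β u
  ... | y∉α , y∉β = (λ { (here refl) → All-lookup x∉ (∈-++⁺ʳ α (here refl)) refl
                        ; (there y∈α) → y∉α y∈α }) , y∉β

  unique-∷ʳ⁺ : ∀ {A : Set} {xs : List A} {y} → Unique xs → y ∉ xs → Unique (xs ++ [ y ])
  unique-∷ʳ⁺ {xs = []}     _        _   = [] ∷ []
  unique-∷ʳ⁺ {xs = x ∷ xs} (x∉ ∷ u) y∉ =
    ∷ʳ⁺ x∉ (λ x≡y → y∉ (here (sym x≡y))) ∷ unique-∷ʳ⁺ u (y∉ ∘ there)

  unique-∷ʳ⁻ : ∀ {A : Set} (xs : List A) {y} → Unique (xs ++ [ y ]) → Unique xs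
  unique-∷ʳ⁻ []       _        = []
  unique-∷ʳ⁻ (x ∷ xs) (x∉ ∷ u) = ++⁻ˡ xs x∉ ∷ unique-∷ʳ⁻ xs u

  last-∷ʳ : ∀ {A : Set} (xs : List A) x → last (xs ++ [ x ]) ≡ just x
  last-∷ʳ []           x = refl
  last-∷ʳ (y ∷ [])     x = refl
  last-∷ʳ (y ∷ z ∷ xs) x = last-∷ʳ (z ∷ xs) x

  Below Above : ℕ → List ℕ → Set
  Below y xs = ∀ {x} → x ∈ xs → x < y
  Above y xs = ∀ {x} → x ∈ xs → y < x

  map-suc-pred : ∀ xs → Above 0 xs → map suc (map pred xs) ≡ xs
  map-suc-pred []           _     = refl
  map-suc-pred (suc x ∷ xs) above = cong (suc x ∷_) (map-suc-pred xs (above ∘ there))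
  map-suc-pred (zero ∷ xs)  above = ⊥-elim (<-irrefl refl (above (here refl)))

  record IsPerm (n : ℕ) (π : List ℕ) : Set where
    field
      length≡  : length π ≡ n
      bounded  : Bounded n π
      distinct : Unique π

  -- By the pigeonhole principle, a permutation of [1,n] contains every element of [1,n].
  perm-∋ : ∀ {n π v} → IsPerm n π → 1 ≤ v → v ≤ n → v ∈ π
  perm-∋ {n} {π} {v} perm 1≤v v≤n with any? (v ≟_) π
  ... | yes v∈π = v∈π
  ... | no v∉π  = ⊥-elim (<-irrefl refl (begin-strict
    length π           <⟨ n<1+n (length π) ⟩
    length (v ∷ π)     ≤⟨ unique⇒length≤ (¬Any⇒All¬ π v∉π ∷ distinct) ⊆range ⟩
    length (range 1 n) ≡⟨ length-applyUpTo _ n ⟩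
    n                  ≡⟨ sym length≡ ⟩
    length π           ∎))
    where
    open IsPerm perm
    open ≤-Reasoning
    ⊆range : ∀ {x} → x ∈ v ∷ π → x ∈ range 1 n
    ⊆range (here refl) = ∈-range⁺ 1≤v v≤n
    ⊆range (there x∈)  = ∈-range⁺ (proj₁ (bounded x∈)) (proj₂ (bounded x∈))

  perm-split : ∀ {m π} → IsPerm (suc m) π → ∃₂ λ α β → π ≡ α ++ suc m ∷ β × Bounded m α × Bounded m β
  perm-split {m} {π} perm with ∈-∃++ (perm-∋ perm (s≤s z≤n) ≤-refl)
  ... | α , β , refl = α , β , refl , lower α-bnd top∉α , lower β-bnd top∉β
    where
    open IsPerm perm
    top∉α : suc m ∉ α
    top∉α = proj₁ (unique-middle α β distinct)
    top∉β : suc m ∉ β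
    top∉β = proj₂ (unique-middle α β distinct)
    α-bnd : Bounded (suc m) α
    α-bnd = bounded ∘ ∈-++⁺ˡ
    β-bnd : Bounded (suc m) β
    β-bnd = bounded ∘ ∈-++⁺ʳ α ∘ there
    lower : ∀ {xs} → Bounded (suc m) xs → suc m ∉ xs → Bounded m xs
    lower bnd top∉ {x} x∈ = proj₁ (bnd x∈) , ≤-pred (≤∧≢⇒< (proj₂ (bnd x∈)) (λ { refl → top∉ x∈ }))

  perm-last : ∀ {m π} → IsPerm (suc m) π → ∃ λ v → last π ≡ just v × 1 ≤ v × v ≤ suc m
  perm-last {π = π} p with initLast π
  ... | []     = ⊥-elim (0≢1+n (IsPerm.length≡ p))
  ... | σ ∷ʳ′ x = x , last-∷ʳ σ x , IsPerm.bounded p (∈-++⁺ʳ σ (here refl))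

  perm-snoc-top⁺ : ∀ {m σ} → IsPerm m σ → IsPerm (suc m) (σ ++ [ suc m ])
  perm-snoc-top⁺ {m} {σ} p = record
    { length≡  = trans (length-++ σ) (trans (+-comm (length σ) 1) (cong suc length≡))
    ; bounded  = λ x∈ → case (∈-∷ʳ⁻ σ x∈)
    ; distinct = unique-∷ʳ⁺ distinct (λ top∈ → <-irrefl refl (proj₂ (bounded top∈)))
    }
    where
    open IsPerm p
    case : ∀ {x} → x ∈ σ ⊎ x ≡ suc m → 1 ≤ x × x ≤ suc m
    case (inj₁ x∈)   = proj₁ (bounded x∈) , m≤n⇒m≤1+n (proj₂ (bounded x∈))
    case (inj₂ refl) = s≤s z≤n , ≤-refl

  perm-snoc-top⁻ : ∀ {m σ} → IsPerm (suc m) (σ ++ [ suc m ]) → IsPerm m σ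
  perm-snoc-top⁻ {m} {σ} p = record
    { length≡  = suc-injective (trans (+-comm 1 (length σ)) (trans (sym (length-++ σ)) length≡))
    ; bounded  = λ x∈ → proj₁ (bounded (∈-++⁺ˡ x∈)) ,
                        ≤-pred (≤∧≢⇒< (proj₂ (bounded (∈-++⁺ˡ x∈))) (λ { refl → top∉σ x∈ }))
    ; distinct = unique-∷ʳ⁻ σ distinct
    }
    where
    open IsPerm p
    top∉σ : suc m ∉ σ
    top∉σ = proj₁ (unique-middle σ [] distinct)

  perm-snoc-bottom⁺ : ∀ {m σ} → IsPerm m σ → IsPerm (suc m) (map suc σ ++ [ 1 ])
  perm-snoc-bottom⁺ {m} {σ} p = record
    { length≡  = trans (length-++ (map suc σ)) (trans (+-comm (length (map suc σ)) 1)
                       (cong suc (trans (length-map suc σ) length≡)))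
    ; bounded  = λ x∈ → case (∈-∷ʳ⁻ (map suc σ) x∈)
    ; distinct = unique-∷ʳ⁺ (Unique.map⁺ suc-injective distinct) one∉
    }
    where
    open IsPerm p
    case : ∀ {x} → x ∈ map suc σ ⊎ x ≡ 1 → 1 ≤ x × x ≤ suc m
    case (inj₁ x∈) with ∈-map⁻ suc x∈
    ... | y , y∈ , refl = s≤s z≤n , s≤s (proj₂ (bounded y∈))
    case (inj₂ refl) = ≤-refl , s≤s z≤n
    one∉ : 1 ∉ map suc σ
    one∉ 1∈ with ∈-map⁻ suc 1∈
    ... | y , y∈ , refl = <-irrefl refl (proj₁ (bounded y∈))

  perm-snoc-bottom⁻ : ∀ {m σ} → IsPerm (suc m) (σ ++ [ 1 ]) → IsPerm m (map pred σ)
  perm-snoc-bottom⁻ {m} {σ} p = record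
    { length≡  = trans (length-map pred σ)
                   (suc-injective (trans (+-comm 1 (length σ)) (trans (sym (length-++ σ)) length≡)))
    ; bounded  = bnd
    ; distinct = UniqueS.map⁻ (setoid ℕ) (setoid ℕ) (cong suc)
                   (subst Unique (sym (map-suc-pred σ (<⇒≤ ∘ above-1))) (unique-∷ʳ⁻ σ distinct))
    }
    where
    open IsPerm p
    one∉σ : 1 ∉ σ
    one∉σ = proj₁ (unique-middle σ [] distinct)
    above-1 : Above 1 σ
    above-1 x∈ = ≤∧≢⇒< (proj₁ (bounded (∈-++⁺ˡ x∈))) (λ { refl → one∉σ x∈ })
    bnd : Bounded m (map pred σ)
    bnd y∈ with ∈-map⁻ pred y∈
    ... | suc (suc y) , x∈ , refl = s≤s z≤n , ≤-pred (proj₂ (bounded (∈-++⁺ˡ x∈)))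
    ... | suc zero    , x∈ , refl = ⊥-elim (one∉σ x∈)
    ... | zero        , x∈ , refl = ⊥-elim (<-irrefl refl (proj₁ (bounded (∈-++⁺ˡ x∈))))

  elemᵇ⇒∈ : ∀ {x} xs → T (elemᵇ x xs) → x ∈ xs
  elemᵇ⇒∈ {x} (y ∷ ys) t with to T-∨ t
  ... | inj₁ x≡ᵇy = here (≡ᵇ⇒≡ x y x≡ᵇy)
  ... | inj₂ t′   = there (elemᵇ⇒∈ ys t′)

  ∈⇒elemᵇ : ∀ {x xs} → x ∈ xs → T (elemᵇ x xs)
  ∈⇒elemᵇ {x} (here refl) = from T-∨ (inj₁ (≡⇒≡ᵇ x x refl))
  ∈⇒elemᵇ (there x∈)      = from T-∨ (inj₂ (∈⇒elemᵇ x∈))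

  allᵇ⇒ : ∀ {A : Set} (p : A → Bool) xs → T (allᵇ p xs) → ∀ {x} → x ∈ xs → T (p x)
  allᵇ⇒ p (y ∷ ys) t (here refl) = proj₁ (to T-∧ t)
  allᵇ⇒ p (y ∷ ys) t (there x∈)  = allᵇ⇒ p ys (proj₂ (to T-∧ t)) x∈

  ⇒allᵇ : ∀ {A : Set} (p : A → Bool) xs → (∀ {x} → x ∈ xs → T (p x)) → T (allᵇ p xs)
  ⇒allᵇ p []       _ = tt
  ⇒allᵇ p (y ∷ ys) f = from T-∧ (f (here refl) , ⇒allᵇ p ys (f ∘ there))

  anyᵇ⇒ : ∀ {A : Set} (p : A → Bool) xs → T (anyᵇ p xs) → ∃ λ x → x ∈ xs × T (p x)
  anyᵇ⇒ p (y ∷ ys) t with to T-∨ t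
  ... | inj₁ py = y , here refl , py
  ... | inj₂ t′ with anyᵇ⇒ p ys t′
  ...   | x , x∈ , px = x , there x∈ , px

  ⇒anyᵇ : ∀ {A : Set} (p : A → Bool) xs {x} → x ∈ xs → T (p x) → T (anyᵇ p xs)
  ⇒anyᵇ p (y ∷ ys) (here refl) px = from T-∨ (inj₁ px)
  ⇒anyᵇ p (y ∷ ys) (there x∈)  px = from T-∨ (inj₂ (⇒anyᵇ p ys x∈ px))

  distinctᵇ⇒Unique : ∀ xs → T (distinctᵇ xs) → Unique xs
  distinctᵇ⇒Unique []       _ = []
  distinctᵇ⇒Unique (x ∷ xs) t with to T-∧ t
  ... | x∉ , t′ = ¬Any⇒All¬ xs (λ x∈ → notT x∉ (∈⇒elemᵇ x∈)) ∷ distinctᵇ⇒Unique xs t′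
    where
    notT : ∀ {b} → T (not b) → ¬ T b
    notT {true}  ()
    notT {false} _ ()

  Unique⇒distinctᵇ : ∀ {xs} → Unique xs → T (distinctᵇ xs)
  Unique⇒distinctᵇ {[]}     _          = tt
  Unique⇒distinctᵇ {x ∷ xs} (x∉ ∷ u) =
    from T-∧ (Tnot (λ t → All¬⇒¬Any x∉ (elemᵇ⇒∈ xs t)) , Unique⇒distinctᵇ u)
    where
    Tnot : ∀ {b} → ¬ T b → T (not b)
    Tnot {true}  ¬t = ¬t tt
    Tnot {false} _  = tt

  sameSetᵇ⇒ : ∀ S U → T (sameSetᵇ S U) → (∀ {x} → x ∈ S → x ∈ U) × (∀ {x} → x ∈ U → x ∈ S)
  sameSetᵇ⇒ S U t with to T-∧ t
  ... | S⊆U , U⊆S = (λ x∈ → elemᵇ⇒∈ U (allᵇ⇒ _ S S⊆U x∈)) , (λ x∈ → elemᵇ⇒∈ S (allᵇ⇒ _ U U⊆S x∈))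

  ⇒sameSetᵇ : ∀ S U → (∀ {x} → x ∈ S → x ∈ U) → (∀ {x} → x ∈ U → x ∈ S) → T (sameSetᵇ S U)
  ⇒sameSetᵇ S U S⊆U U⊆S =
    from T-∧ (⇒allᵇ _ S (∈⇒elemᵇ ∘ S⊆U) , ⇒allᵇ _ U (∈⇒elemᵇ ∘ U⊆S))

  -- Cyclic intervals.  An interval of ℤ_n with endpoints 1 ≤ a ≤ b ≤ n is
  -- either straight, {a,…,b}, or wrapped, {b,…,n,1,…,a}.  Sets are handled as
  -- predicates, compared pointwise on [1,n].
  Straight : ℕ → ℕ → ℕ → Set
  Straight a b x = a ≤ x × x ≤ b

  Wrapped : ℕ → ℕ → ℕ → ℕ → Set
  Wrapped n a b x = Straight b n x ⊎ Straight 1 a x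

  Endpoints : ℕ → ℕ → ℕ → Set
  Endpoints n a b = 1 ≤ a × a ≤ b × b ≤ n

  infix 4 _≐_on_
  _≐_on_ : (ℕ → Set) → (ℕ → Set) → ℕ → Set
  P ≐ Q on n = ∀ x → 1 ≤ x → x ≤ n → P x ⇔ Q x

  CyclicInterval : ℕ → (ℕ → Set) → Set
  CyclicInterval n P = ∃₂ λ a b → Endpoints n a b × (P ≐ Straight a b on n ⊎ P ≐ Wrapped n a b on n)

  ≐-sym : ∀ {n P Q} → P ≐ Q on n → Q ≐ P on n
  ≐-sym P≐Q x 1≤x x≤n = ⇔.sym (P≐Q x 1≤x x≤n)

  ≐-trans : ∀ {n P Q R} → P ≐ Q on n → Q ≐ R on n → P ≐ R on n
  ≐-trans P≐Q Q≐R x 1≤x x≤n = ⇔.trans (P≐Q x 1≤x x≤n) (Q≐R x 1≤x x≤n)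

  ≐-∘ : ∀ {n P Q} {g : ℕ → ℕ} → (∀ {x} → 1 ≤ x → x ≤ n → 1 ≤ g x × g x ≤ n) →
        P ≐ Q on n → (P ∘ g) ≐ (Q ∘ g) on n
  ≐-∘ g-range P≐Q x 1≤x x≤n = let 1≤gx , gx≤n = g-range 1≤x x≤n in P≐Q _ 1≤gx gx≤n

  cyclic-resp : ∀ {n P Q} → P ≐ Q on n → CyclicInterval n P → CyclicInterval n Q
  cyclic-resp P≐Q (a , b , ends , inj₁ P≐I) = a , b , ends , inj₁ (≐-trans (≐-sym P≐Q) P≐I)
  cyclic-resp P≐Q (a , b , ends , inj₂ P≐W) = a , b , ends , inj₂ (≐-trans (≐-sym P≐Q) P≐W)

  ∈-wrapped⁺ : ∀ {n a b x} → Wrapped n a b x → x ∈ range b n ++ range 1 a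
  ∈-wrapped⁺ {n} {b = b} (inj₁ (b≤x , x≤n)) = ∈-++⁺ˡ (∈-range⁺ b≤x x≤n)
  ∈-wrapped⁺ {n} {b = b} (inj₂ (1≤x , x≤a)) = ∈-++⁺ʳ (range b n) (∈-range⁺ 1≤x x≤a)

  ∈-wrapped⁻ : ∀ {n a b x} → x ∈ range b n ++ range 1 a → Wrapped n a b x
  ∈-wrapped⁻ {n} {b = b} x∈ with ∈-++⁻ (range b n) x∈
  ... | inj₁ x∈₁ = inj₁ (∈-range⁻ x∈₁)
  ... | inj₂ x∈₂ = inj₂ (∈-range⁻ x∈₂)

  interval⇒cyclic : ∀ n S → T (isIntervalᵇ n S) → CyclicInterval n (_∈ S)
  interval⇒cyclic n S t with anyᵇ⇒ _ (range 1 n) t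
  ... | a , a∈ , t′ with anyᵇ⇒ _ (range 1 n) t′
  ... | b , b∈ , t″ with to T-∧ t″
  ... | a≤ᵇb , shape with ∈-range⁻ a∈ | ∈-range⁻ b∈ | to T-∨ shape
  ... | 1≤a , _ | _ , b≤n | inj₁ same = a , b , (1≤a , ≤ᵇ⇒≤ a b a≤ᵇb , b≤n) ,
    inj₁ (λ x _ _ → let S⊆ , ⊆S = sameSetᵇ⇒ S (range a b) same in
                    mk⇔ (∈-range⁻ ∘ S⊆) (λ (a≤x , x≤b) → ⊆S (∈-range⁺ a≤x x≤b)))
  ... | 1≤a , _ | _ , b≤n | inj₂ same = a , b , (1≤a , ≤ᵇ⇒≤ a b a≤ᵇb , b≤n) ,
    inj₂ (λ x _ _ → let S⊆ , ⊆S = sameSetᵇ⇒ S (range b n ++ range 1 a) same in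
                    mk⇔ (∈-wrapped⁻ ∘ S⊆) (⊆S ∘ ∈-wrapped⁺))

  cyclic⇒interval : ∀ n S → Bounded n S → CyclicInterval n (_∈ S) → T (isIntervalᵇ n S)
  cyclic⇒interval n S bnd (a , b , (1≤a , a≤b , b≤n) , shape) =
    ⇒anyᵇ _ (range 1 n) (∈-range⁺ 1≤a (≤-trans a≤b b≤n))
      (⇒anyᵇ _ (range 1 n) (∈-range⁺ (≤-trans 1≤a a≤b) b≤n)
        (from T-∧ (≤⇒≤ᵇ a≤b , from T-∨ (same shape))))
    where
    same : (_∈ S) ≐ Straight a b on n ⊎ (_∈ S) ≐ Wrapped n a b on n →
           T (sameSetᵇ S (range a b)) ⊎ T (sameSetᵇ S (range b n ++ range 1 a))
    same (inj₁ S≐I) = inj₁ (⇒sameSetᵇ S (range a b)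
      (λ {x} x∈ → let 1≤x , x≤n = bnd x∈ ; a≤x , x≤b = to (S≐I x 1≤x x≤n) x∈ in ∈-range⁺ a≤x x≤b)
      (λ {x} x∈ → let a≤x , x≤b = ∈-range⁻ x∈ in
                  from (S≐I x (≤-trans 1≤a a≤x) (≤-trans x≤b b≤n)) (a≤x , x≤b)))
    same (inj₂ S≐W) = inj₂ (⇒sameSetᵇ S (range b n ++ range 1 a)
      (λ {x} x∈ → let 1≤x , x≤n = bnd x∈ in ∈-wrapped⁺ (to (S≐W x 1≤x x≤n) x∈))
      (λ {x} x∈ → let w = ∈-wrapped⁻ {n} {a} {b} x∈ in from (S≐W x (lower w) (upper w)) w))
      where
      lower : ∀ {x} → Wrapped n a b x → 1 ≤ x
      lower (inj₁ (b≤x , _)) = ≤-trans (≤-trans 1≤a a≤b) b≤x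
      lower (inj₂ (1≤x , _)) = 1≤x
      upper : ∀ {x} → Wrapped n a b x → x ≤ n
      upper (inj₁ (_ , x≤n)) = x≤n
      upper (inj₂ (_ , x≤a)) = ≤-trans x≤a (≤-trans a≤b b≤n)

  rot : ℕ → ℕ → ℕ
  rot n x with x ≟ n
  ... | yes _ = 1
  ... | no _  = suc x

  rot⁻¹ : ℕ → ℕ → ℕ
  rot⁻¹ n zero          = zero
  rot⁻¹ n (suc zero)    = n
  rot⁻¹ n (suc (suc y)) = suc y

  rot-cases : ∀ n x → (x ≡ n × rot n x ≡ 1) ⊎ (x ≢ n × rot n x ≡ suc x)
  rot-cases n x with x ≟ n
  ... | yes x≡n = inj₁ (x≡n , refl)
  ... | no x≢n  = inj₂ (x≢n , refl)

  rot-n : ∀ n → rot n n ≡ 1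
  rot-n n with n ≟ n
  ... | yes _  = refl
  ... | no n≢n = ⊥-elim (n≢n refl)

  rot-≢ : ∀ {n x} → x ≢ n → rot n x ≡ suc x
  rot-≢ {n} {x} x≢n with x ≟ n
  ... | yes x≡n = ⊥-elim (x≢n x≡n)
  ... | no _    = refl

  rot-bounded : ∀ {n x} → 1 ≤ x → x ≤ n → 1 ≤ rot n x × rot n x ≤ n
  rot-bounded {n} {x} 1≤x x≤n with x ≟ n
  ... | yes _   = s≤s z≤n , ≤-trans 1≤x x≤n
  ... | no x≢n  = s≤s z≤n , ≤∧≢⇒< x≤n x≢n

  rot⁻¹-bounded : ∀ {n x} → 1 ≤ x → x ≤ n → 1 ≤ rot⁻¹ n x × rot⁻¹ n x ≤ n
  rot⁻¹-bounded {x = suc zero}    _ x≤n = x≤n , ≤-refl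
  rot⁻¹-bounded {x = suc (suc y)} _ x≤n = s≤s z≤n , ≤-trans (n≤1+n _) x≤n

  rot⁻¹-rot : ∀ {n x} → 1 ≤ x → x ≤ n → rot⁻¹ n (rot n x) ≡ x
  rot⁻¹-rot {n} {x} _ _ with x ≟ n
  ... | yes x≡n = sym x≡n
  rot⁻¹-rot {n} {suc y} _ _ | no _ = refl

  rot-rot⁻¹ : ∀ {n x} → 1 ≤ x → x ≤ n → rot n (rot⁻¹ n x) ≡ x
  rot-rot⁻¹ {n} {suc zero}    _ _   = rot-n n
  rot-rot⁻¹ {n} {suc (suc y)} _ x≤n = rot-≢ (λ y+1≡n → <-irrefl y+1≡n x≤n)

  -- How the two shapes transform under precomposition with rot⁻¹, i.e. under
  -- rotating the underlying set forward.  Each case is settled by whether x is 1.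
  straight-shift : ∀ {n a b} → 1 ≤ a → b < n → Straight a b ∘ rot⁻¹ n ≐ Straight (suc a) (suc b) on n
  straight-shift 1≤a b<n (suc zero) _ _ =
    mk⇔ (λ (_ , n≤b) → ⊥-elim (<-irrefl refl (≤-<-trans n≤b b<n)))
        (λ { (s≤s a≤0 , _) → ⊥-elim (<-irrefl refl (≤-trans 1≤a a≤0)) })
  straight-shift 1≤a b<n (suc (suc y)) _ _ =
    mk⇔ (λ (a≤ , ≤b) → s≤s a≤ , s≤s ≤b) (λ (a≤ , ≤b) → ≤-pred a≤ , ≤-pred ≤b)

  straight-top : ∀ {n a} → a < n → Straight a n ∘ rot⁻¹ n ≐ Wrapped n 1 (suc a) on n
  straight-top a<n (suc zero) _ _ = mk⇔ (λ _ → inj₂ (≤-refl , ≤-refl)) (λ _ → <⇒≤ a<n , ≤-refl)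
  straight-top a<n (suc (suc y)) _ x≤n =
    mk⇔ (λ (a≤ , _) → inj₁ (s≤s a≤ , x≤n))
        (λ { (inj₁ (a<x , _)) → ≤-pred a<x , ≤-trans (n≤1+n _) x≤n ; (inj₂ (_ , s≤s ())) })

  point-top : ∀ {n} → Straight n n ∘ rot⁻¹ n ≐ Straight 1 1 on n
  point-top (suc zero) _ _ = mk⇔ (λ _ → ≤-refl , ≤-refl) (λ _ → ≤-refl , ≤-refl)
  point-top (suc (suc y)) _ x≤n =
    mk⇔ (λ (n≤ , _) → ⊥-elim (<-irrefl refl (<-≤-trans x≤n n≤))) (λ { (_ , s≤s ()) })

  wrapped-shift : ∀ {n a b} → b < n → Wrapped n a b ∘ rot⁻¹ n ≐ Wrapped n (suc a) (suc b) on n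
  wrapped-shift b<n (suc zero) _ _ = mk⇔ (λ _ → inj₂ (≤-refl , s≤s z≤n)) (λ _ → inj₁ (<⇒≤ b<n , ≤-refl))
  wrapped-shift b<n (suc (suc y)) _ x≤n =
    mk⇔ (λ { (inj₁ (b≤ , _)) → inj₁ (s≤s b≤ , x≤n) ; (inj₂ (_ , ≤a)) → inj₂ (s≤s z≤n , s≤s ≤a) })
        (λ { (inj₁ (b<x , _)) → inj₁ (≤-pred b<x , ≤-trans (n≤1+n _) x≤n)
           ; (inj₂ (_ , x≤a+1)) → inj₂ (s≤s z≤n , ≤-pred x≤a+1) })

  wrapped-top : ∀ {n a} → a < n → Wrapped n a n ∘ rot⁻¹ n ≐ Straight 1 (suc a) on n
  wrapped-top a<n (suc zero) _ _ = mk⇔ (λ _ → ≤-refl , s≤s z≤n) (λ _ → inj₁ (≤-refl , ≤-refl))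
  wrapped-top a<n (suc (suc y)) _ x≤n =
    mk⇔ (λ { (inj₁ (n≤ , _)) → ⊥-elim (<-irrefl refl (<-≤-trans x≤n n≤))
           ; (inj₂ (_ , ≤a))  → s≤s z≤n , s≤s ≤a })
        (λ (_ , x≤a+1) → inj₂ (s≤s z≤n , ≤-pred x≤a+1))

  everything-top : ∀ {n} → Wrapped n n n ∘ rot⁻¹ n ≐ Straight 1 n on n
  everything-top x 1≤x x≤n = mk⇔ (λ _ → 1≤x , x≤n) (λ _ → inj₂ (rot⁻¹-bounded 1≤x x≤n))

  cyclic-∘rot⁻¹ : ∀ {n P} → CyclicInterval n P → CyclicInterval n (P ∘ rot⁻¹ n)
  cyclic-∘rot⁻¹ {n} (a , b , (1≤a , a≤b , b≤n) , shape) with m≤n⇒m<n∨m≡n b≤n | m≤n⇒m<n∨m≡n a≤b | shape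
  ... | inj₁ b<n  | _         | inj₁ P≐I = suc a , suc b , (s≤s z≤n , s≤s a≤b , b<n) ,
                                           inj₁ (≐-trans (≐-∘ rot⁻¹-bounded P≐I) (straight-shift 1≤a b<n))
  ... | inj₁ b<n  | _         | inj₂ P≐W = suc a , suc b , (s≤s z≤n , s≤s a≤b , b<n) ,
                                           inj₂ (≐-trans (≐-∘ rot⁻¹-bounded P≐W) (wrapped-shift b<n))
  ... | inj₂ refl | inj₁ a<n  | inj₁ P≐I = 1 , suc a , (≤-refl , s≤s z≤n , a<n) ,
                                           inj₂ (≐-trans (≐-∘ rot⁻¹-bounded P≐I) (straight-top a<n))
  ... | inj₂ refl | inj₁ a<n  | inj₂ P≐W = 1 , suc a , (≤-refl , s≤s z≤n , a<n) ,
                                           inj₁ (≐-trans (≐-∘ rot⁻¹-bounded P≐W) (wrapped-top a<n))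
  ... | inj₂ refl | inj₂ refl | inj₁ P≐I = 1 , 1 , (≤-refl , ≤-refl , 1≤a) ,
                                           inj₁ (≐-trans (≐-∘ rot⁻¹-bounded P≐I) point-top)
  ... | inj₂ refl | inj₂ refl | inj₂ P≐W = 1 , a , (≤-refl , 1≤a , ≤-refl) ,
                                           inj₁ (≐-trans (≐-∘ rot⁻¹-bounded P≐W) everything-top)

  -- How the two shapes transform under precomposition with rot, i.e. under
  -- rotating the underlying set backward.  Each case is settled by whether x is n.
  straight-unshift : ∀ {n a b} → 1 ≤ a → suc b ≤ n → Straight (suc a) (suc b) ∘ rot n ≐ Straight a b on n
  straight-unshift {n} 1≤a b<n x _ _ with rot-cases n x
  ... | inj₁ (refl , eq) rewrite eq =
    mk⇔ (λ { (s≤s a≤0 , _) → ⊥-elim (<-irrefl refl (≤-trans 1≤a a≤0)) })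
        (λ (_ , n≤b) → ⊥-elim (<-irrefl refl (≤-<-trans n≤b b<n)))
  ... | inj₂ (_ , eq) rewrite eq =
    mk⇔ (λ (a<x , x<b) → ≤-pred a<x , ≤-pred x<b) (λ (a≤x , x≤b) → s≤s a≤x , s≤s x≤b)

  point-bottom : ∀ {n} → Straight 1 1 ∘ rot n ≐ Straight n n on n
  point-bottom {n} x 1≤x _ with rot-cases n x
  ... | inj₁ (refl , eq) rewrite eq = mk⇔ (λ _ → ≤-refl , ≤-refl) (λ _ → ≤-refl , ≤-refl)
  ... | inj₂ (x≢n , eq) rewrite eq =
    mk⇔ (λ (_ , x<1) → ⊥-elim (<-irrefl refl (<-≤-trans (s≤s 1≤x) x<1)))
        (λ (n≤x , x≤n) → ⊥-elim (x≢n (≤-antisym x≤n n≤x)))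

  straight-bottom : ∀ {n b} → 1 ≤ b → Straight 1 (suc b) ∘ rot n ≐ Wrapped n b n on n
  straight-bottom {n} 1≤b x 1≤x _ with rot-cases n x
  ... | inj₁ (refl , eq) rewrite eq = mk⇔ (λ _ → inj₁ (≤-refl , ≤-refl)) (λ _ → ≤-refl , s≤s z≤n)
  ... | inj₂ (x≢n , eq) rewrite eq =
    mk⇔ (λ (_ , x<b) → inj₂ (1≤x , ≤-pred x<b))
        (λ { (inj₁ (n≤x , x≤n)) → ⊥-elim (x≢n (≤-antisym x≤n n≤x))
           ; (inj₂ (_ , x≤b))   → s≤s z≤n , s≤s x≤b })

  wrapped-unshift : ∀ {n a b} → suc b ≤ n → Wrapped n (suc a) (suc b) ∘ rot n ≐ Wrapped n a b on n
  wrapped-unshift {n} b<n x 1≤x x≤n with rot-cases n x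
  ... | inj₁ (refl , eq) rewrite eq = mk⇔ (λ _ → inj₁ (<⇒≤ b<n , ≤-refl)) (λ _ → inj₂ (≤-refl , s≤s z≤n))
  ... | inj₂ (x≢n , eq) rewrite eq =
    mk⇔ (λ { (inj₁ (b<x , _)) → inj₁ (≤-pred b<x , x≤n) ; (inj₂ (_ , x<a)) → inj₂ (1≤x , ≤-pred x<a) })
        (λ { (inj₁ (b≤x , _)) → inj₁ (s≤s b≤x , ≤∧≢⇒< x≤n x≢n)
           ; (inj₂ (_ , x≤a)) → inj₂ (s≤s z≤n , s≤s x≤a) })

  wrapped-bottom : ∀ {n b} → suc b ≤ n → Wrapped n 1 (suc b) ∘ rot n ≐ Straight b n on n
  wrapped-bottom {n} b<n x 1≤x x≤n with rot-cases n x
  ... | inj₁ (refl , eq) rewrite eq = mk⇔ (λ _ → <⇒≤ b<n , ≤-refl) (λ _ → inj₂ (≤-refl , ≤-refl))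
  ... | inj₂ (x≢n , eq) rewrite eq =
    mk⇔ (λ { (inj₁ (b<x , _)) → ≤-pred b<x , x≤n
           ; (inj₂ (_ , x<1)) → ⊥-elim (<-irrefl refl (<-≤-trans (s≤s 1≤x) x<1)) })
        (λ (b≤x , _) → inj₁ (s≤s b≤x , ≤∧≢⇒< x≤n x≢n))

  everything-bottom : ∀ {n} → Wrapped n 1 1 ∘ rot n ≐ Straight 1 n on n
  everything-bottom x 1≤x x≤n = mk⇔ (λ _ → 1≤x , x≤n) (λ _ → inj₁ (rot-bounded 1≤x x≤n))

  cyclic-∘rot : ∀ {n P} → CyclicInterval n P → CyclicInterval n (P ∘ rot n)
  cyclic-∘rot (zero , _ , (() , _) , _)
  cyclic-∘rot (suc (suc a) , suc zero , (_ , s≤s () , _) , _)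
  cyclic-∘rot {n} (suc zero , suc zero , (_ , _ , 1≤n) , inj₁ P≐I) =
    n , n , (1≤n , ≤-refl , ≤-refl) , inj₁ (≐-trans (≐-∘ rot-bounded P≐I) point-bottom)
  cyclic-∘rot {n} (suc zero , suc zero , (_ , _ , 1≤n) , inj₂ P≐W) =
    1 , n , (≤-refl , 1≤n , ≤-refl) , inj₁ (≐-trans (≐-∘ rot-bounded P≐W) everything-bottom)
  cyclic-∘rot {n} (suc zero , suc (suc b) , (_ , _ , b<n) , inj₁ P≐I) =
    suc b , n , (s≤s z≤n , <⇒≤ b<n , ≤-refl) , inj₂ (≐-trans (≐-∘ rot-bounded P≐I) (straight-bottom (s≤s z≤n)))
  cyclic-∘rot {n} (suc zero , suc (suc b) , (_ , _ , b<n) , inj₂ P≐W) =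
    suc b , n , (s≤s z≤n , <⇒≤ b<n , ≤-refl) , inj₁ (≐-trans (≐-∘ rot-bounded P≐W) (wrapped-bottom b<n))
  cyclic-∘rot {n} (suc (suc a) , suc (suc b) , (_ , a≤b , b<n) , inj₁ P≐I) =
    suc a , suc b , (s≤s z≤n , ≤-pred a≤b , <⇒≤ b<n) ,
    inj₁ (≐-trans (≐-∘ rot-bounded P≐I) (straight-unshift (s≤s z≤n) b<n))
  cyclic-∘rot {n} (suc (suc a) , suc (suc b) , (_ , a≤b , b<n) , inj₂ P≐W) =
    suc a , suc b , (s≤s z≤n , ≤-pred a≤b , <⇒≤ b<n) , inj₂ (≐-trans (≐-∘ rot-bounded P≐W) (wrapped-unshift b<n))

  words-cartesian : ∀ n k → words n (suc k) ≡ cartesianProductWith _∷_ (range 1 n) (words n k)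
  words-cartesian n k = go (range 1 n)
    where
    go : ∀ xs → concatMap (λ x → map (x ∷_) (words n k)) xs ≡ cartesianProductWith _∷_ xs (words n k)
    go []       = refl
    go (x ∷ xs) = cong (map (x ∷_) (words n k) ++_) (go xs)

  ∈-words⁻ : ∀ n k {π} → π ∈ words n k → length π ≡ k × Bounded n π
  ∈-words⁻ n zero    (here refl) = refl , λ ()
  ∈-words⁻ n (suc k) π∈ with ∈-cartesianProductWith⁻ _∷_ (range 1 n) (words n k) (subst (_ ∈_) (words-cartesian n k) π∈)
  ... | x , w , x∈ , w∈ , refl with ∈-words⁻ n k w∈
  ... | len , bnd = cong suc len , λ { (here refl) → ∈-range⁻ x∈ ; (there y∈) → bnd y∈ }

  ∈-words⁺ : ∀ n k {π} → length π ≡ k → Bounded n π → π ∈ words n k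
  ∈-words⁺ n zero    {[]}    _   _   = here refl
  ∈-words⁺ n (suc k) {x ∷ π} len bnd = subst (_ ∈_) (sym (words-cartesian n k))
    (∈-cartesianProductWith⁺ _∷_ (∈-range⁺ (proj₁ (bnd (here refl))) (proj₂ (bnd (here refl))))
                                 (∈-words⁺ n k (suc-injective len) (bnd ∘ there)))

  words-unique : ∀ n k → Unique (words n k)
  words-unique n zero    = [] ∷ []
  words-unique n (suc k) = subst Unique (sym (words-cartesian n k))
    (Unique.cartesianProductWith⁺ _∷_ ∷-injective (range-unique 1 n) (words-unique n k))

  record IsArc (n : ℕ) (π : List ℕ) : Set where
    field
      perm     : IsPerm n π
      prefixes : ∀ j → 1 ≤ j → j ≤ n → T (isIntervalᵇ n (take j π))
    open IsPerm perm public

  ∈-Arc⁻ : ∀ {n π} → π ∈ Arc n → IsArc n π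
  ∈-Arc⁻ {n} {π} π∈ with ∈-filter⁻ (λ π → T? (isArcᵇ n π)) π∈
  ... | π∈Sym , arc with ∈-filter⁻ (λ w → T? (distinctᵇ w)) π∈Sym
  ... | π∈words , dist = record
    { perm     = record { length≡  = proj₁ (∈-words⁻ n n π∈words)
                        ; bounded  = proj₂ (∈-words⁻ n n π∈words)
                        ; distinct = distinctᵇ⇒Unique π dist }
    ; prefixes = λ j 1≤j j≤n → allᵇ⇒ _ (range 1 n) arc (∈-range⁺ 1≤j j≤n)
    }

  ∈-Arc⁺ : ∀ {n π} → IsArc n π → π ∈ Arc n
  ∈-Arc⁺ {n} {π} arc = ∈-filter⁺ (λ π → T? (isArcᵇ n π))
    (∈-filter⁺ (λ w → T? (distinctᵇ w)) (∈-words⁺ n n length≡ bounded) (Unique⇒distinctᵇ distinct))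
    (⇒allᵇ _ (range 1 n) (λ j∈ → let 1≤j , j≤n = ∈-range⁻ j∈ in prefixes _ 1≤j j≤n))
    where open IsArc arc

  Arc-unique : ∀ n → Unique (Arc n)
  Arc-unique n = Unique.filter⁺ _ (Unique.filter⁺ _ (words-unique n n))

  record Relabelling (n : ℕ) : Set where
    field
      fwd bwd     : ℕ → ℕ
      fwd-bounded : ∀ {x} → 1 ≤ x → x ≤ n → 1 ≤ fwd x × fwd x ≤ n
      bwd-bounded : ∀ {x} → 1 ≤ x → x ≤ n → 1 ≤ bwd x × bwd x ≤ n
      bwd-fwd     : ∀ {x} → 1 ≤ x → x ≤ n → bwd (fwd x) ≡ x
      fwd-bwd     : ∀ {x} → 1 ≤ x → x ≤ n → fwd (bwd x) ≡ x

  inverse : ∀ {n} → Relabelling n → Relabelling n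
  inverse σ = record
    { fwd = bwd ; bwd = fwd ; fwd-bounded = bwd-bounded ; bwd-bounded = fwd-bounded
    ; bwd-fwd = fwd-bwd ; fwd-bwd = bwd-fwd }
    where open Relabelling σ

  rotation : ∀ n → Relabelling n
  rotation n = record
    { fwd = rot n ; bwd = rot⁻¹ n ; fwd-bounded = rot-bounded ; bwd-bounded = rot⁻¹-bounded
    ; bwd-fwd = rot⁻¹-rot ; fwd-bwd = rot-rot⁻¹ }

  module Relabel {n : ℕ} (σ : Relabelling n) where
    open Relabelling σ

    map-bounded : ∀ {xs} → Bounded n xs → Bounded n (map fwd xs)
    map-bounded bnd y∈ with ∈-map⁻ fwd y∈
    ... | x , x∈ , refl = fwd-bounded (proj₁ (bnd x∈)) (proj₂ (bnd x∈))

    map-bwd-fwd : ∀ {xs} → Bounded n xs → map bwd (map fwd xs) ≡ xs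
    map-bwd-fwd {[]}     _   = refl
    map-bwd-fwd {x ∷ xs} bnd = cong₂ _∷_ (bwd-fwd (proj₁ (bnd (here refl))) (proj₂ (bnd (here refl))))
                                         (map-bwd-fwd (bnd ∘ there))

    map-fwd-injective : ∀ {xs ys} → Bounded n xs → Bounded n ys → map fwd xs ≡ map fwd ys → xs ≡ ys
    map-fwd-injective {xs} {ys} bx by eq =
      trans (sym (map-bwd-fwd bx)) (trans (cong (map bwd) eq) (map-bwd-fwd by))

    map-unique : ∀ {xs} → Bounded n xs → Unique xs → Unique (map fwd xs)
    map-unique bnd u = UniqueS.map⁻ (setoid ℕ) (setoid ℕ) (cong bwd) (subst Unique (sym (map-bwd-fwd bnd)) u)

    map-perm : ∀ {π} → IsPerm n π → IsPerm n (map fwd π)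
    map-perm {π} p = record
      { length≡  = trans (length-map fwd π) length≡
      ; bounded  = map-bounded bounded
      ; distinct = map-unique bounded distinct
      }
      where open IsPerm p

    ∈-map : ∀ {S} → Bounded n S → (_∈ map fwd S) ≐ (λ x → bwd x ∈ S) on n
    ∈-map {S} bnd x 1≤x x≤n = mk⇔ out (λ bx∈ → subst (_∈ map fwd S) (fwd-bwd 1≤x x≤n) (∈-map⁺ fwd bx∈))
      where
      out : x ∈ map fwd S → bwd x ∈ S
      out x∈ with ∈-map⁻ fwd x∈
      ... | y , y∈ , refl = subst (_∈ S) (sym (bwd-fwd (proj₁ (bnd y∈)) (proj₂ (bnd y∈)))) y∈

    map-arc : (∀ {P} → CyclicInterval n P → CyclicInterval n (P ∘ bwd)) →
              ∀ {π} → IsArc n π → IsArc n (map fwd π)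
    map-arc pull {π} arc = record
      { perm     = map-perm perm
      ; prefixes = λ j 1≤j j≤n → subst (T ∘ isIntervalᵇ n) (sym (take-map j π))
          (cyclic⇒interval n _ (map-bounded (bounded ∘ ∈-take j π))
            (cyclic-resp (≐-sym (∈-map (bounded ∘ ∈-take j π)))
              (pull (interval⇒cyclic n _ (prefixes j 1≤j j≤n)))))
      }
      where open IsArc arc

  arc-rot : ∀ {n π} → IsArc n π → IsArc n (map (rot n) π)
  arc-rot {n} = Relabel.map-arc (rotation n) cyclic-∘rot⁻¹

  arc-rot⁻¹ : ∀ {n π} → IsArc n π → IsArc n (map (rot⁻¹ n) π)
  arc-rot⁻¹ {n} = Relabel.map-arc (inverse (rotation n)) cyclic-∘rot

  <ᵇ-true : ∀ {a b} → a < b → (a <ᵇ b) ≡ true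
  <ᵇ-true {zero}  {suc b} _         = refl
  <ᵇ-true {suc a} {suc b} (s≤s a<b) = <ᵇ-true a<b

  <ᵇ-false : ∀ {a b} → b ≤ a → (a <ᵇ b) ≡ false
  <ᵇ-false {a}     {zero}  _         = refl
  <ᵇ-false {suc a} {suc b} (s≤s b≤a) = <ᵇ-false b≤a

  majFrom-suc : ∀ i xs → majFrom i (map suc xs) ≡ majFrom i xs
  majFrom-suc i []           = refl
  majFrom-suc i (x ∷ [])     = refl
  majFrom-suc i (x ∷ y ∷ ys) = cong ((if y <ᵇ x then i else 0) +_) (majFrom-suc (suc i) (y ∷ ys))

  majFrom-max : ∀ i xs y → Below y xs → majFrom i (xs ++ [ y ]) ≡ majFrom i xs
  majFrom-max i []           y _ = refl
  majFrom-max i (x ∷ [])     y below rewrite <ᵇ-false {y} {x} (<⇒≤ (below (here refl))) = refl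
  majFrom-max i (x ∷ x′ ∷ xs) y below =
    cong ((if x′ <ᵇ x then i else 0) +_) (majFrom-max (suc i) (x′ ∷ xs) y (below ∘ there))

  majFrom-min : ∀ i x xs y → Above y (x ∷ xs) →
                majFrom i ((x ∷ xs) ++ [ y ]) ≡ majFrom i (x ∷ xs) + (i + length xs)
  majFrom-min i x []        y above rewrite <ᵇ-true {y} {x} (above (here refl)) | +-identityʳ i = refl
  majFrom-min i x (x′ ∷ xs) y above = begin
    d + majFrom (suc i) ((x′ ∷ xs) ++ [ y ])     ≡⟨ cong (d +_) (majFrom-min (suc i) x′ xs y (above ∘ there)) ⟩
    d + (M + (suc i + length xs))                ≡⟨ sym (+-assoc d M _) ⟩
    d + M + (suc i + length xs)                  ≡⟨ cong (d + M +_) (sym (+-suc i (length xs))) ⟩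
    d + M + (i + length (x′ ∷ xs))               ∎
    where
    open ≡-Reasoning
    d M : ℕ
    d = if x′ <ᵇ x then i else 0
    M = majFrom (suc i) (x′ ∷ xs)

  maj-min : ∀ xs y → Above y xs → maj (xs ++ [ y ]) ≡ maj xs + length xs
  maj-min []       y _     = refl
  maj-min (x ∷ xs) y above = majFrom-min 1 x xs y above

  majFrom-split : ∀ i α y β → majFrom i (α ++ y ∷ β) ≡ majFrom i (α ++ [ y ]) + majFrom (i + length α) (y ∷ β)
  majFrom-split i []            y β = cong (λ k → majFrom k (y ∷ β)) (sym (+-identityʳ i))
  majFrom-split i (x ∷ [])      y β = cong₂ (λ e k → e + majFrom k (y ∷ β)) (sym (+-identityʳ d)) (+-comm 1 i)
    where
    d : ℕ
    d = if y <ᵇ x then i else 0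
  majFrom-split i (x ∷ x′ ∷ α) y β = begin
    d + majFrom (suc i) (x′ ∷ α ++ y ∷ β)
      ≡⟨ cong (d +_) (majFrom-split (suc i) (x′ ∷ α) y β) ⟩
    d + (majFrom (suc i) (x′ ∷ α ++ [ y ]) + majFrom (suc i + length (x′ ∷ α)) (y ∷ β))
      ≡⟨ sym (+-assoc d _ _) ⟩
    d + majFrom (suc i) (x′ ∷ α ++ [ y ]) + majFrom (suc i + length (x′ ∷ α)) (y ∷ β)
      ≡⟨ cong (λ k → d + majFrom (suc i) (x′ ∷ α ++ [ y ]) + majFrom k (y ∷ β)) (sym (+-suc i (length (x′ ∷ α)))) ⟩
    d + majFrom (suc i) (x′ ∷ α ++ [ y ]) + majFrom (i + length (x ∷ x′ ∷ α)) (y ∷ β) ∎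
    where
    open ≡-Reasoning
    d : ℕ
    d = if x′ <ᵇ x then i else 0

  -- Rotating α ++ n ∷ β (n = m + 1, all other letters in [1,m], β nonempty)
  -- lowers maj by one: the descent after n at position |α|+1 is replaced by the
  -- descent before 1 at position |α| (which is no descent if α is empty).
  maj-rot : ∀ {m} α b β → Bounded m α → b ≤ m →
            maj (map suc α ++ 1 ∷ map suc (b ∷ β)) + 1 ≡ maj (α ++ suc m ∷ b ∷ β)
  maj-rot {m} α b β α-bnd b≤m = begin
    maj (map suc α ++ 1 ∷ map suc (b ∷ β)) + 1
      ≡⟨ cong (_+ 1) (majFrom-split 1 (map suc α) 1 (map suc (b ∷ β))) ⟩
    maj (map suc α ++ [ 1 ]) + majFrom (2 + length (map suc α)) (suc b ∷ map suc β) + 1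
      ≡⟨ cong₂ (λ u v → u + v + 1) shifted-prefix (cong (λ k → majFrom (2 + k) (suc b ∷ map suc β)) (length-map suc α)) ⟩
    maj α + length α + majFrom (2 + length α) (suc b ∷ map suc β) + 1
      ≡⟨ cong (λ v → maj α + length α + v + 1) (majFrom-suc (2 + length α) (b ∷ β)) ⟩
    maj α + length α + M + 1
      ≡⟨ arithmetic (maj α) (length α) M ⟩
    maj α + ((1 + length α) + M)
      ≡⟨ cong₂ (λ u v → u + (v + M)) (sym (majFrom-max 1 α (suc m) α<n)) (sym (if-true (<ᵇ-true (s≤s b≤m)))) ⟩
    majFrom 1 (α ++ [ suc m ]) + majFrom (1 + length α) (suc m ∷ b ∷ β)
      ≡⟨ sym (majFrom-split 1 α (suc m) (b ∷ β)) ⟩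
    maj (α ++ suc m ∷ b ∷ β) ∎
    where
    open ≡-Reasoning
    M : ℕ
    M = majFrom (2 + length α) (b ∷ β)
    α<n : Below (suc m) α
    α<n x∈ = s≤s (proj₂ (α-bnd x∈))
    shifted-prefix : maj (map suc α ++ [ 1 ]) ≡ maj α + length α
    shifted-prefix = trans (maj-min (map suc α) 1 above-1)
                           (cong₂ _+_ (majFrom-suc 1 α) (length-map suc α))
      where
      above-1 : Above 1 (map suc α)
      above-1 x∈ with ∈-map⁻ suc x∈
      ... | x , x∈α , refl = s≤s (proj₁ (α-bnd x∈α))
    if-true : ∀ {b′ : Bool} {k} → b′ ≡ true → (if b′ then k else 0) ≡ k
    if-true refl = refl
    arithmetic : ∀ a l m → a + l + m + 1 ≡ a + ((1 + l) + m)
    arithmetic = solve-∀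

  -- The number of letters of xs smaller than x, so that inv (x ∷ xs) = smaller x xs + inv xs.
  smaller : ℕ → List ℕ → ℕ
  smaller x xs = length (filter (λ y → T? (y <ᵇ x)) xs)

  smaller-++ : ∀ x xs ys → smaller x (xs ++ ys) ≡ smaller x xs + smaller x ys
  smaller-++ x xs ys = trans (cong length (filter-++ (λ y → T? (y <ᵇ x)) xs ys)) (length-++ (filter _ xs))

  smaller-suc : ∀ x xs → smaller (suc x) (map suc xs) ≡ smaller x xs
  smaller-suc x []       = refl
  smaller-suc x (y ∷ ys) with y <ᵇ x
  ... | true  = cong suc (smaller-suc x ys)
  ... | false = smaller-suc x ys

  smaller-all : ∀ x xs → Below x xs → smaller x xs ≡ length xs
  smaller-all x []       _     = refl
  smaller-all x (y ∷ ys) below rewrite <ᵇ-true (below (here refl)) = cong suc (smaller-all x ys (below ∘ there))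

  smaller-none : ∀ x xs → (∀ {y} → y ∈ xs → x ≤ y) → smaller x xs ≡ 0
  smaller-none x []       _     = refl
  smaller-none x (y ∷ ys) above rewrite <ᵇ-false (above (here refl)) = smaller-none x ys (above ∘ there)

  inv-suc : ∀ xs → inv (map suc xs) ≡ inv xs
  inv-suc []       = refl
  inv-suc (x ∷ xs) = cong₂ _+_ (smaller-suc x xs) (inv-suc xs)

  inv-max : ∀ xs y → Below y xs → inv (xs ++ [ y ]) ≡ inv xs
  inv-max []       y _     = refl
  inv-max (x ∷ xs) y below = cong₂ _+_ last-not-smaller (inv-max xs y (below ∘ there))
    where
    open ≡-Reasoning
    y-above : x < y
    y-above = below (here refl)
    last-not-smaller : smaller x (xs ++ [ y ]) ≡ smaller x xs
    last-not-smaller = begin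
      smaller x (xs ++ [ y ])      ≡⟨ smaller-++ x xs [ y ] ⟩
      smaller x xs + smaller x [ y ] ≡⟨ cong (smaller x xs +_) (smaller-none x [ y ] λ { (here refl) → <⇒≤ y-above }) ⟩
      smaller x xs + 0             ≡⟨ +-identityʳ _ ⟩
      smaller x xs                 ∎

  inv-min : ∀ xs y → Above y xs → inv (xs ++ [ y ]) ≡ inv xs + length xs
  inv-min []       y _     = refl
  inv-min (x ∷ xs) y above = begin
    smaller x (xs ++ [ y ]) + inv (xs ++ [ y ])
      ≡⟨ cong₂ _+_ (smaller-++ x xs [ y ]) (inv-min xs y (above ∘ there)) ⟩
    smaller x xs + smaller x [ y ] + (inv xs + length xs)
      ≡⟨ cong (λ k → smaller x xs + k + (inv xs + length xs)) (smaller-all x [ y ] λ { (here refl) → above (here refl) }) ⟩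
    smaller x xs + 1 + (inv xs + length xs)
      ≡⟨ arithmetic (smaller x xs) (inv xs) (length xs) ⟩
    smaller x xs + inv xs + suc (length xs) ∎
    where
    open ≡-Reasoning
    arithmetic : ∀ s i l → s + 1 + (i + l) ≡ s + i + suc l
    arithmetic = solve-∀

  -- Rotating α ++ n ∷ β (n = m + 1, all other letters in [1,m]): every letter of α
  -- gains an inversion with the new 1, and the |β| inversions of n are lost.
  inv-rot : ∀ {m} α β → Bounded m α → Bounded m β →
            inv (map suc α ++ 1 ∷ map suc β) + length β ≡ inv (α ++ suc m ∷ β) + length α
  inv-rot {m} [] β _ β-bnd = begin
    smaller 1 (map suc β) + inv (map suc β) + length β
      ≡⟨ cong₂ (λ u v → u + v + length β) (trans (smaller-suc 0 β) (smaller-none 0 β (λ _ → z≤n))) (inv-suc β) ⟩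
    inv β + length β
      ≡⟨ +-comm (inv β) (length β) ⟩
    length β + inv β
      ≡⟨ cong (_+ inv β) (sym (smaller-all (suc m) β (λ y∈ → s≤s (proj₂ (β-bnd y∈))))) ⟩
    smaller (suc m) β + inv β
      ≡⟨ sym (+-identityʳ _) ⟩
    smaller (suc m) β + inv β + 0 ∎
    where open ≡-Reasoning
  inv-rot {m} (x ∷ α) β α-bnd β-bnd = begin
    smaller (suc x) (map suc α ++ 1 ∷ map suc β) + inv (map suc α ++ 1 ∷ map suc β) + length β
      ≡⟨ +-assoc (smaller (suc x) (map suc α ++ 1 ∷ map suc β)) _ _ ⟩
    smaller (suc x) (map suc α ++ 1 ∷ map suc β) + (inv (map suc α ++ 1 ∷ map suc β) + length β)
      ≡⟨ cong₂ _+_ gains-one (inv-rot α β (α-bnd ∘ there) β-bnd) ⟩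
    suc (smaller x α + smaller x β) + (inv (α ++ suc m ∷ β) + length α)
      ≡⟨ arithmetic (smaller x α + smaller x β) (inv (α ++ suc m ∷ β)) (length α) ⟩
    smaller x α + smaller x β + inv (α ++ suc m ∷ β) + suc (length α)
      ≡⟨ cong (λ k → k + inv (α ++ suc m ∷ β) + suc (length α)) (sym loses-n) ⟩
    smaller x (α ++ suc m ∷ β) + inv (α ++ suc m ∷ β) + suc (length α) ∎
    where
    open ≡-Reasoning
    1≤x : 1 ≤ x
    1≤x = proj₁ (α-bnd (here refl))
    x≤m : x ≤ m
    x≤m = proj₂ (α-bnd (here refl))
    gains-one : smaller (suc x) (map suc α ++ 1 ∷ map suc β) ≡ suc (smaller x α + smaller x β)
    gains-one rewrite smaller-++ (suc x) (map suc α) (1 ∷ map suc β) | <ᵇ-true {1} {suc x} (s≤s 1≤x)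
                    | smaller-suc x α | smaller-suc x β = +-suc (smaller x α) (smaller x β)
    loses-n : smaller x (α ++ suc m ∷ β) ≡ smaller x α + smaller x β
    loses-n rewrite smaller-++ x α (suc m ∷ β) | <ᵇ-false {suc m} {x} (m≤n⇒m≤1+n x≤m) = refl
    arithmetic : ∀ s i l → suc s + (i + l) ≡ s + i + suc l
    arithmetic = solve-∀

  map-rot-low : ∀ {m} xs → Bounded m xs → map (rot (suc m)) xs ≡ map suc xs
  map-rot-low []       _   = refl
  map-rot-low (x ∷ xs) bnd = cong₂ _∷_ (rot-≢ (λ x≡n → <-irrefl x≡n (s≤s (proj₂ (bnd (here refl))))))
                                       (map-rot-low xs (bnd ∘ there))

  map-rot-split : ∀ {m} α β → Bounded m α → Bounded m β →
                  map (rot (suc m)) (α ++ suc m ∷ β) ≡ map suc α ++ 1 ∷ map suc β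
  map-rot-split {m} α β α-bnd β-bnd = begin
    map (rot (suc m)) (α ++ suc m ∷ β)                          ≡⟨ map-++ (rot (suc m)) α (suc m ∷ β) ⟩
    map (rot (suc m)) α ++ rot (suc m) (suc m) ∷ map (rot (suc m)) β
      ≡⟨ cong₂ (λ u v → u ++ v) (map-rot-low α α-bnd) (cong₂ _∷_ (rot-n (suc m)) (map-rot-low β β-bnd)) ⟩
    map suc α ++ 1 ∷ map suc β                                   ∎
    where open ≡-Reasoning

  maj-perm-rot : ∀ {m π} → IsPerm (suc m) π → last π ≢ just (suc m) → maj (map (rot (suc m)) π) + 1 ≡ maj π
  maj-perm-rot {m} perm last≢n with perm-split perm
  ... | α , []    , refl , _             = ⊥-elim (last≢n (last-∷ʳ α (suc m)))
  ... | α , b ∷ β , refl , α-bnd , β-bnd =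
    trans (cong (λ w → maj w + 1) (map-rot-split α (b ∷ β) α-bnd β-bnd))
          (maj-rot α b β α-bnd (proj₂ (β-bnd (here refl))))

  -- Rotating a permutation of [1,n] changes inv by n - 1 modulo 2.
  inv-perm-rot : ∀ {m π} → IsPerm (suc m) π → ∃ λ a → inv (map (rot (suc m)) π) + m ≡ inv π + (a + a)
  inv-perm-rot {m} perm with perm-split perm
  ... | α , β , refl , α-bnd , β-bnd = length α , (begin
    inv (map (rot (suc m)) (α ++ suc m ∷ β)) + m
      ≡⟨ cong₂ (λ w k → inv w + k) (map-rot-split α β α-bnd β-bnd) (sym split-length) ⟩
    inv (map suc α ++ 1 ∷ map suc β) + (length α + length β)
      ≡⟨ cong (inv (map suc α ++ 1 ∷ map suc β) +_) (+-comm (length α) (length β)) ⟩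
    inv (map suc α ++ 1 ∷ map suc β) + (length β + length α)
      ≡⟨ sym (+-assoc (inv (map suc α ++ 1 ∷ map suc β)) (length β) (length α)) ⟩
    inv (map suc α ++ 1 ∷ map suc β) + length β + length α
      ≡⟨ cong (_+ length α) (inv-rot α β α-bnd β-bnd) ⟩
    inv (α ++ suc m ∷ β) + length α + length α
      ≡⟨ +-assoc (inv (α ++ suc m ∷ β)) (length α) (length α) ⟩
    inv (α ++ suc m ∷ β) + (length α + length α) ∎)
    where
    open ≡-Reasoning
    split-length : length α + length β ≡ m
    split-length = suc-injective (trans (sym (+-suc (length α) (length β)))
                                        (trans (sym (length-++ α)) (IsPerm.length≡ perm)))

  IsStraight : ℕ → (ℕ → Set) → Set
  IsStraight m P = ∃₂ λ a b → Endpoints m a b × P ≐ Straight a b on m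

  perm-whole : ∀ {m σ} → IsPerm m σ → 1 ≤ m → IsStraight m (_∈ take m σ)
  perm-whole {m} {σ} p 1≤m = 1 , m , (≤-refl , 1≤m , ≤-refl) , λ x 1≤x x≤m →
    subst (λ S → x ∈ S ⇔ Straight 1 m x) (sym (take-all m σ (≤-reflexive length≡)))
          (mk⇔ bounded (λ _ → perm-∋ p 1≤x x≤m))
    where open IsPerm p

  cyclic-below-top : ∀ {m P} → CyclicInterval (suc m) P → ¬ P (suc m) → IsStraight m P
  cyclic-below-top {m} (a , b , (1≤a , a≤b , b≤n) , inj₁ P≐I) top∉ with m≤n⇒m<n∨m≡n b≤n
  ... | inj₁ b<n  = a , b , (1≤a , a≤b , ≤-pred b<n) , λ x 1≤x x≤m → P≐I x 1≤x (m≤n⇒m≤1+n x≤m)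
  ... | inj₂ refl = ⊥-elim (top∉ (from (P≐I (suc m) (≤-trans 1≤a a≤b) ≤-refl) (≤-trans a≤b b≤n , ≤-refl)))
  cyclic-below-top {m} (a , b , (1≤a , a≤b , b≤n) , inj₂ P≐W) top∉ =
    ⊥-elim (top∉ (from (P≐W (suc m) (≤-trans 1≤a (≤-trans a≤b b≤n)) ≤-refl) (inj₁ (b≤n , ≤-refl))))

  straight-widen : ∀ {m P} → IsStraight m P → ¬ P (suc m) → IsStraight (suc m) P
  straight-widen {m} {P} (a , b , (1≤a , a≤b , b≤m) , P≐I) top∉ = a , b , (1≤a , a≤b , m≤n⇒m≤1+n b≤m) , P≐I′
    where
    P≐I′ : P ≐ Straight a b on suc m
    P≐I′ x 1≤x x≤n with m≤n⇒m<n∨m≡n x≤n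
    ... | inj₁ x<n  = P≐I x 1≤x (≤-pred x<n)
    ... | inj₂ refl = mk⇔ (⊥-elim ∘ top∉) (λ (_ , n≤b) → ⊥-elim (<-irrefl refl (≤-trans n≤b b≤m)))

  straight-suc : ∀ {m S} → Above 0 S → IsStraight m (_∈ S) → IsStraight (suc m) (_∈ map suc S)
  straight-suc {m} {S} S≥1 (a , b , (1≤a , a≤b , b≤m) , S≐I) =
    suc a , suc b , (s≤s z≤n , s≤s a≤b , s≤s b≤m) , shifted
    where
    shifted : (_∈ map suc S) ≐ Straight (suc a) (suc b) on suc m
    shifted (suc zero) _ _ = mk⇔ (⊥-elim ∘ one∉) (λ (a<1 , _) → ⊥-elim (<-irrefl refl (≤-trans (s≤s 1≤a) a<1)))
      where
      one∉ : 1 ∉ map suc S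
      one∉ 1∈ with ∈-map⁻ suc 1∈
      ... | _ , 0∈ , refl = <-irrefl refl (S≥1 0∈)
    shifted (suc (suc y)) _ x≤n =
      mk⇔ (λ x∈ → let a≤ , ≤b = to (S≐I (suc y) (s≤s z≤n) (≤-pred x≤n)) (unshift x∈) in s≤s a≤ , s≤s ≤b)
          (λ (a≤ , ≤b) → ∈-map⁺ suc (from (S≐I (suc y) (s≤s z≤n) (≤-pred x≤n)) (≤-pred a≤ , ≤-pred ≤b)))
      where
      unshift : suc (suc y) ∈ map suc S → suc y ∈ S
      unshift x∈ with ∈-map⁻ suc x∈
      ... | _ , w∈ , refl = w∈

  straight-pred : ∀ {m S} → Above 0 S → 1 ∉ S → IsStraight (suc m) (_∈ S) → IsStraight m (_∈ map pred S)
  straight-pred S≥1 1∉ (zero , _ , (() , _) , _)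
  straight-pred S≥1 1∉ (suc zero , b , (_ , 1≤b , _) , S≐I) =
    ⊥-elim (1∉ (from (S≐I 1 ≤-refl (s≤s z≤n)) (≤-refl , 1≤b)))
  straight-pred S≥1 1∉ (suc (suc a) , zero , (_ , () , _) , _)
  straight-pred {m} {S} S≥1 1∉ (suc (suc a) , suc b , (_ , s≤s a<b , s≤s b≤m) , S≐I) =
    suc a , b , (s≤s z≤n , a<b , b≤m) , shifted
    where
    unshift : ∀ {y} → y ∈ map pred S → suc y ∈ S
    unshift y∈ with ∈-map⁻ pred y∈
    ... | suc w , w∈ , refl = w∈
    ... | zero  , w∈ , _    = ⊥-elim (<-irrefl refl (S≥1 w∈))
    shifted : (_∈ map pred S) ≐ Straight (suc a) b on m
    shifted y 1≤y y≤m =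
      mk⇔ (λ y∈ → let a<y , y<b = to (S≐I (suc y) (s≤s z≤n) (s≤s y≤m)) (unshift y∈) in ≤-pred a<y , ≤-pred y<b)
          (λ (a≤y , y≤b) → ∈-map⁺ pred (from (S≐I (suc y) (s≤s z≤n) (s≤s y≤m)) (s≤s a≤y , s≤s y≤b)))

  record IsLinearArc (m : ℕ) (σ : List ℕ) : Set where
    field
      perm     : IsPerm m σ
      prefixes : ∀ j → 1 ≤ j → j ≤ m → IsStraight m (_∈ take j σ)
    open IsPerm perm public

  linear⇒arc : ∀ {n π} → IsLinearArc n π → IsArc n π
  linear⇒arc {n} {π} L = record
    { perm     = perm
    ; prefixes = λ j 1≤j j≤n → let a , b , ends , P≐I = prefixes j 1≤j j≤n in
                 cyclic⇒interval n (take j π) (bounded ∘ ∈-take j π) (a , b , ends , inj₁ P≐I)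
    }
    where open IsLinearArc L

  arc⇒linear : ∀ {m σ} → IsArc (suc m) (σ ++ [ suc m ]) → IsLinearArc m σ
  arc⇒linear {m} {σ} arc = record
    { perm     = σ-perm
    ; prefixes = λ j 1≤j j≤m →
        cyclic-below-top
          (subst (λ S → CyclicInterval (suc m) (_∈ S))
                 (take-++ˡ j σ _ (≤-trans j≤m (≤-reflexive (sym (IsPerm.length≡ σ-perm)))))
            (interval⇒cyclic (suc m) _ (prefixes j 1≤j (m≤n⇒m≤1+n j≤m))))
          (λ top∈ → <-irrefl refl (proj₂ (IsPerm.bounded σ-perm (∈-take j σ top∈))))
    }
    where
    open IsArc arc
    σ-perm : IsPerm m σ
    σ-perm = perm-snoc-top⁻ perm

  linear-snoc-top⁺ : ∀ {m σ} → IsLinearArc m σ → IsLinearArc (suc m) (σ ++ [ suc m ])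
  linear-snoc-top⁺ {m} {σ} L = record { perm = perm-snoc-top⁺ perm ; prefixes = extended }
    where
    open IsLinearArc L
    extended : ∀ j → 1 ≤ j → j ≤ suc m → IsStraight (suc m) (_∈ take j (σ ++ [ suc m ]))
    extended j 1≤j j≤n with m≤n⇒m<n∨m≡n j≤n
    ... | inj₁ j<n  = subst (λ S → IsStraight (suc m) (_∈ S))
                            (sym (take-++ˡ j σ _ (≤-trans (≤-pred j<n) (≤-reflexive (sym length≡)))))
                            (straight-widen (prefixes j 1≤j (≤-pred j<n))
                                            (λ top∈ → <-irrefl refl (proj₂ (bounded (∈-take j σ top∈)))))
    ... | inj₂ refl = perm-whole (perm-snoc-top⁺ perm) (s≤s z≤n)

  linear-snoc-bottom⁺ : ∀ {m σ} → IsLinearArc m σ → IsLinearArc (suc m) (map suc σ ++ [ 1 ])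
  linear-snoc-bottom⁺ {m} {σ} L = record { perm = perm-snoc-bottom⁺ perm ; prefixes = extended }
    where
    open IsLinearArc L
    extended : ∀ j → 1 ≤ j → j ≤ suc m → IsStraight (suc m) (_∈ take j (map suc σ ++ [ 1 ]))
    extended j 1≤j j≤n with m≤n⇒m<n∨m≡n j≤n
    ... | inj₁ j<n  = subst (λ S → IsStraight (suc m) (_∈ S))
                            (sym (trans (take-++ˡ j (map suc σ) _ fits) (take-map j σ)))
                            (straight-suc (proj₁ ∘ bounded ∘ ∈-take j σ) (prefixes j 1≤j (≤-pred j<n)))
      where
      fits : j ≤ length (map suc σ)
      fits = ≤-trans (≤-pred j<n) (≤-reflexive (sym (trans (length-map suc σ) length≡)))
    ... | inj₂ refl = perm-whole (perm-snoc-bottom⁺ perm) (s≤s z≤n)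

  linear-snoc-top⁻ : ∀ {m σ} → IsLinearArc (suc m) (σ ++ [ suc m ]) → IsLinearArc m σ
  linear-snoc-top⁻ = arc⇒linear ∘ linear⇒arc

  linear-snoc-bottom⁻ : ∀ {m σ} → IsLinearArc (suc m) (σ ++ [ 1 ]) → IsLinearArc m (map pred σ)
  linear-snoc-bottom⁻ {m} {σ} L = record { perm = perm-snoc-bottom⁻ perm ; prefixes = restricted }
    where
    open IsLinearArc L
    one∉σ : 1 ∉ σ
    one∉σ = proj₁ (unique-middle σ [] distinct)
    restricted : ∀ j → 1 ≤ j → j ≤ m → IsStraight m (_∈ take j (map pred σ))
    restricted j 1≤j j≤m =
      subst (λ S → IsStraight m (_∈ S)) (sym (take-map j σ))
        (straight-pred (proj₁ ∘ bounded ∘ ∈-++⁺ˡ ∘ ∈-take j σ) (one∉σ ∘ ∈-take j σ)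
          (subst (λ S → IsStraight (suc m) (_∈ S)) (take-++ˡ j σ _ fits) (prefixes j 1≤j (m≤n⇒m≤1+n j≤m))))
      where
      fits : j ≤ length σ
      fits = ≤-trans j≤m (≤-reflexive (sym (trans (sym (length-map pred σ)) (IsPerm.length≡ (perm-snoc-bottom⁻ perm)))))

  -- The last letter of a linear arc permutation of [1,m], m ≥ 2, is m or 1:
  -- the remaining letters form an interval containing both 1 and m unless it is.
  linear-last : ∀ {k σ x} → IsLinearArc (suc (suc k)) (σ ++ [ x ]) → x ≡ suc (suc k) ⊎ x ≡ 1
  linear-last {k} {σ} {x} L with x ≟ suc (suc k) | x ≟ 1
  ... | yes x≡m | _       = inj₁ x≡m
  ... | no _    | yes x≡1 = inj₂ x≡1
  ... | no x≢m  | no x≢1  = ⊥-elim (absurd (subst (λ S → IsStraight (suc (suc k)) (_∈ S)) init-prefix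
                                                  (prefixes (suc k) (s≤s z≤n) (n≤1+n _))))
    where
    open IsLinearArc L
    x∉σ : x ∉ σ
    x∉σ = proj₁ (unique-middle σ [] distinct)
    σ-length : length σ ≡ suc k
    σ-length = suc-injective (trans (+-comm 1 (length σ)) (trans (sym (length-++ σ)) length≡))
    init-prefix : take (suc k) (σ ++ [ x ]) ≡ σ
    init-prefix = trans (take-++ˡ (suc k) σ _ (≤-reflexive (sym σ-length))) (take-all (suc k) σ (≤-reflexive σ-length))
    in-σ : ∀ {y} → 1 ≤ y → y ≤ suc (suc k) → y ≢ x → y ∈ σ
    in-σ 1≤y y≤m y≢x with ∈-∷ʳ⁻ σ (perm-∋ perm 1≤y y≤m)
    ... | inj₁ y∈σ = y∈σ
    ... | inj₂ y≡x = ⊥-elim (y≢x y≡x)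
    x-bounds : 1 ≤ x × x ≤ suc (suc k)
    x-bounds = bounded (∈-++⁺ʳ σ (here refl))
    absurd : IsStraight (suc (suc k)) (_∈ σ) → ⊥
    absurd (a , b , _ , σ≐I) = x∉σ (from (σ≐I x (proj₁ x-bounds) (proj₂ x-bounds))
                                         (≤-trans a≤1 (proj₁ x-bounds) , ≤-trans (proj₂ x-bounds) m≤b))
      where
      a≤1 : a ≤ 1
      a≤1 = proj₁ (to (σ≐I 1 ≤-refl (s≤s z≤n)) (in-σ ≤-refl (s≤s z≤n) (x≢1 ∘ sym)))
      m≤b : suc (suc k) ≤ b
      m≤b = proj₂ (to (σ≐I (suc (suc k)) (s≤s z≤n) ≤-refl) (in-σ (s≤s z≤n) ≤-refl (x≢m ∘ sym)))

  bools : ℕ → List (List Bool)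
  bools zero    = [] ∷ []
  bools (suc k) = map (true ∷_) (bools k) ++ map (false ∷_) (bools k)

  ∈-bools⁻ : ∀ k {c} → c ∈ bools k → length c ≡ k
  ∈-bools⁻ zero    (here refl) = refl
  ∈-bools⁻ (suc k) c∈ with ∈-++⁻ (map (true ∷_) (bools k)) c∈
  ... | inj₁ c∈₁ = let _ , c′∈ , eq = ∈-map⁻ (true ∷_) c∈₁ in trans (cong length eq) (cong suc (∈-bools⁻ k c′∈))
  ... | inj₂ c∈₂ = let _ , c′∈ , eq = ∈-map⁻ (false ∷_) c∈₂ in trans (cong length eq) (cong suc (∈-bools⁻ k c′∈))

  ∈-bools⁺ : ∀ c → c ∈ bools (length c)
  ∈-bools⁺ []          = here refl
  ∈-bools⁺ (true ∷ c)  = ∈-++⁺ˡ (∈-map⁺ (true ∷_) (∈-bools⁺ c))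
  ∈-bools⁺ (false ∷ c) = ∈-++⁺ʳ (map (true ∷_) (bools (length c))) (∈-map⁺ (false ∷_) (∈-bools⁺ c))

  bools-unique : ∀ k → Unique (bools k)
  bools-unique zero    = [] ∷ []
  bools-unique (suc k) = Unique.++⁺ (Unique.map⁺ (proj₂ ∘ ∷-injective) (bools-unique k))
                                    (Unique.map⁺ (proj₂ ∘ ∷-injective) (bools-unique k)) disjoint
    where
    disjoint : ∀ {c} → ¬ (c ∈ map (true ∷_) (bools k) × c ∈ map (false ∷_) (bools k))
    disjoint (c∈₁ , c∈₂) with ∈-map⁻ (true ∷_) c∈₁ | ∈-map⁻ (false ∷_) c∈₂
    ... | _ , _ , refl | _ , _ , ()

  -- Its letters are chosen
  -- from the end: the first symbol of c says whether the last letter is the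
  -- maximum (true) or the minimum (false) of [1,|c|+1].
  lin : List Bool → List ℕ
  lin []          = 1 ∷ []
  lin (true ∷ c)  = lin c ++ [ suc (suc (length c)) ]
  lin (false ∷ c) = map suc (lin c) ++ [ 1 ]

  lin-linear : ∀ c → IsLinearArc (suc (length c)) (lin c)
  lin-linear []          = record { perm = singleton ; prefixes = λ { (suc zero) _ _ → perm-whole singleton ≤-refl
                                                                     ; (suc (suc j)) _ (s≤s ()) } }
    where
    singleton : IsPerm 1 (1 ∷ [])
    singleton = record { length≡ = refl ; bounded = λ { (here refl) → ≤-refl , ≤-refl } ; distinct = [] ∷ [] }
  lin-linear (true ∷ c)  = linear-snoc-top⁺ (lin-linear c)
  lin-linear (false ∷ c) = linear-snoc-bottom⁺ (lin-linear c)

  linear⇒lin : ∀ k {σ} → IsLinearArc (suc k) σ → ∃ λ c → length c ≡ k × lin c ≡ σ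
  linear⇒lin zero {x ∷ []} L = [] , refl , cong [_] (≤-antisym (proj₁ x-bounds) (proj₂ x-bounds))
    where
    x-bounds : 1 ≤ x × x ≤ 1
    x-bounds = IsLinearArc.bounded L (here refl)
  linear⇒lin zero {[]}          L = ⊥-elim (0≢1+n (IsLinearArc.length≡ L))
  linear⇒lin zero {_ ∷ _ ∷ _}   L = ⊥-elim (0≢1+n (sym (suc-injective (IsLinearArc.length≡ L))))
  linear⇒lin (suc k) {σ} L with initLast σ
  ... | []       = ⊥-elim (0≢1+n (IsLinearArc.length≡ L))
  ... | σ′ ∷ʳ′ x with linear-last L
  ...   | inj₁ refl with linear⇒lin k (linear-snoc-top⁻ L)
  ...     | c , refl , refl = true ∷ c , refl , refl
  linear⇒lin (suc k) {σ} L | σ′ ∷ʳ′ x | inj₂ refl with linear⇒lin k (linear-snoc-bottom⁻ L)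
  ...     | c , len , lin≡ = false ∷ c , cong suc len ,
                             cong (_++ [ 1 ]) (trans (cong (map suc) lin≡) (map-suc-pred σ′ σ′≥1))
    where
    σ′≥1 : Above 0 σ′
    σ′≥1 = proj₁ ∘ IsLinearArc.bounded L ∘ ∈-++⁺ˡ

  lin-injective : ∀ c c′ → lin c ≡ lin c′ → c ≡ c′
  lin-injective []          []           _  = refl
  lin-injective []          (b ∷ c′)     eq =
    ⊥-elim (0≢1+n (suc-injective (trans (cong length eq) (IsLinearArc.length≡ (lin-linear (b ∷ c′))))))
  lin-injective (b ∷ c)     []           eq =
    ⊥-elim (0≢1+n (suc-injective (trans (cong length (sym eq)) (IsLinearArc.length≡ (lin-linear (b ∷ c))))))
  lin-injective (true ∷ c)  (true ∷ c′)  eq = cong (true ∷_) (lin-injective c c′ (∷ʳ-injectiveˡ (lin c) (lin c′) eq))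
  lin-injective (false ∷ c) (false ∷ c′) eq = cong (false ∷_) (lin-injective c c′
    (map-injective suc-injective (∷ʳ-injectiveˡ (map suc (lin c)) (map suc (lin c′)) eq)))
  lin-injective (true ∷ c)  (false ∷ c′) eq with ∷ʳ-injectiveʳ (lin c) (map suc (lin c′)) eq
  ... | ()
  lin-injective (false ∷ c) (true ∷ c′)  eq with ∷ʳ-injectiveʳ (map suc (lin c)) (lin c′) eq
  ... | ()

  lin-arc : ∀ {k c} → c ∈ bools k → IsArc (suc (suc k)) (lin c ++ [ suc (suc k) ])
  lin-arc {c = c} c∈ = subst (λ l → IsArc (suc (suc l)) (lin c ++ [ suc (suc l) ])) (∈-bools⁻ _ c∈)
                             (linear⇒arc (linear-snoc-top⁺ (lin-linear c)))

  arc⇒lin : ∀ {k π} → IsArc (suc (suc k)) π → last π ≡ just (suc (suc k)) →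
            ∃ λ c → c ∈ bools k × lin c ++ [ suc (suc k) ] ≡ π
  arc⇒lin {k} {π} arc last≡ with initLast π
  ... | σ ∷ʳ′ x with trans (sym (last-∷ʳ σ x)) last≡
  ...   | refl with linear⇒lin k (arc⇒linear arc)
  ...     | c , refl , refl = c , ∈-bools⁺ c , refl


  lin-below : ∀ c → Below (suc (suc (length c))) (lin c)
  lin-below c x∈ = s≤s (proj₂ (IsLinearArc.bounded (lin-linear c) x∈))

  shifted-lin-above : ∀ c → Above 1 (map suc (lin c))
  shifted-lin-above c x∈ with ∈-map⁻ suc x∈
  ... | y , y∈ , refl = s≤s (proj₁ (IsLinearArc.bounded (lin-linear c) y∈))

  shifted-lin-length : ∀ c → length (map suc (lin c)) ≡ suc (length c)
  shifted-lin-length c = trans (length-map suc (lin c)) (IsLinearArc.length≡ (lin-linear c))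

  maj-lin-true : ∀ c → maj (lin (true ∷ c)) ≡ maj (lin c)
  maj-lin-true c = majFrom-max 1 (lin c) _ (lin-below c)

  maj-lin-false : ∀ c → maj (lin (false ∷ c)) ≡ maj (lin c) + suc (length c)
  maj-lin-false c = trans (maj-min (map suc (lin c)) 1 (shifted-lin-above c))
                          (cong₂ _+_ (majFrom-suc 1 (lin c)) (shifted-lin-length c))

  inv-lin-true : ∀ c → inv (lin (true ∷ c)) ≡ inv (lin c)
  inv-lin-true c = inv-max (lin c) _ (lin-below c)

  inv-lin-false : ∀ c → inv (lin (false ∷ c)) ≡ inv (lin c) + suc (length c)
  inv-lin-false c = trans (inv-min (map suc (lin c)) 1 (shifted-lin-above c))
                          (cong₂ _+_ (inv-suc (lin c)) (shifted-lin-length c))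

  maj-lin-top : ∀ {k c} → c ∈ bools k → maj (lin c ++ [ suc (suc k) ]) ≡ maj (lin c)
  maj-lin-top {c = c} c∈ = majFrom-max 1 (lin c) _ (subst (λ l → Below (suc (suc l)) (lin c)) (∈-bools⁻ _ c∈) (lin-below c))

  inv-lin-top : ∀ {k c} → c ∈ bools k → inv (lin c ++ [ suc (suc k) ]) ≡ inv (lin c)
  inv-lin-top {c = c} c∈ = inv-max (lin c) _ (subst (λ l → Below (suc (suc l)) (lin c)) (∈-bools⁻ _ c∈) (lin-below c))


module GeneratingFunctions where

  open import Defs
  open ArcPermutations
  open Sums
  open import Data.Nat as ℕ using (ℕ; zero; suc; _∸_; _≤_; _<_; z≤n; s≤s)
  import Data.Nat.Properties as ℕ
  open import Data.Integer using (ℤ; +_; -_; _+_; _*_; _^_)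
  import Data.Integer.Properties as ℤ
  open import Algebra.Properties.CommutativeSemigroup ℤ.*-commutativeSemigroup using (interchange)
  open import Data.Bool using (Bool; true; false)
  open import Data.List using (List; []; _∷_; _++_; [_]; map; length; last; upTo; foldr)
  open import Data.List.Properties using (map-∘; map-upTo; last-map; ∷ʳ-injectiveˡ; applyUpTo-∷ʳ; map-++)
  open import Data.List.Membership.Propositional using (_∈_)
  open import Data.List.Membership.Propositional.Properties
    using (∈-filter⁺; ∈-filter⁻; ∈-applyUpTo⁺; ∈-applyUpTo⁻; ∈-map⁺)
  open import Data.List.Relation.Unary.Unique.Propositional using (Unique)
  import Data.List.Relation.Unary.Unique.Propositional.Properties as Unique
  open import Data.Maybe as Maybe using (Maybe; just)
  open import Data.Maybe.Properties using (just-injective) renaming (≡-dec to ≡-decᴹ)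
  open import Data.Product using (∃; _×_; _,_; proj₁; proj₂)
  open import Function using (_∘_)
  open import Relation.Binary.Definitions using (DecidableEquality)
  open import Relation.Binary.PropositionalEquality hiding ([_])

  open ≡-Reasoning

  _≟ᴹ_ : DecidableEquality (Maybe ℕ)
  _≟ᴹ_ = ≡-decᴹ ℕ._≟_

  Ending : ℕ → ℕ → List (List ℕ)
  Ending n v = Part _≟ᴹ_ last (Arc n) (just v)

  ∈-Ending⁻ : ∀ n v {π} → π ∈ Ending n v → IsArc n π × last π ≡ just v
  ∈-Ending⁻ n v π∈ with ∈-filter⁻ (λ π → last π ≟ᴹ just v) π∈
  ... | π∈Arc , last≡ = ∈-Arc⁻ π∈Arc , last≡

  ∈-Ending⁺ : ∀ {n v π} → IsArc n π → last π ≡ just v → π ∈ Ending n v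
  ∈-Ending⁺ {n} {v} arc last≡ = ∈-filter⁺ (λ π → last π ≟ᴹ just v) (∈-Arc⁺ arc) last≡

  Ending-unique : ∀ n v → Unique (Ending n v)
  Ending-unique n v = Unique.filter⁺ _ (Arc-unique n)

  below : ∀ {i n} → i ∈ upTo n → i < n
  below i∈ with ∈-applyUpTo⁻ (λ i → i) i∈
  ... | _ , i<n , refl = i<n

  last-map-just : ∀ (f : ℕ → ℕ) π {v} → last π ≡ just v → last (map f π) ≡ just (f v)
  last-map-just f π last≡ = trans (last-map f π) (cong (Maybe.map f) last≡)

  module RotationChain (m : ℕ) (W : List ℕ → ℤ) (z : ℤ)
    (rotation-weight : ∀ {π} → IsArc (suc m) π → last π ≢ just (suc m) → z * W (map (rot (suc m)) π) ≡ W π)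
    where

    S : ℕ → ℤ
    S v = sumℤ (map W (Ending (suc m) v))

    -- Rotation is a bijection from the arc permutations ending in v to those ending in v + 1.
    rotation-step : ∀ {v} → 1 ≤ v → v < suc m → S v ≡ z * S (suc v)
    rotation-step {v} 1≤v v<n = begin
      sumℤ (map W (Ending (suc m) v))
        ≡⟨ sumℤ-cong (Ending (suc m) v)
                     (λ π∈ → sym (rotation-weight (proj₁ (∈-Ending⁻ (suc m) v π∈)) (not-top π∈))) ⟩
      sumℤ (map (λ π → z * W (map (rot (suc m)) π)) (Ending (suc m) v))
        ≡⟨ sumℤ-scaleˡ (Ending (suc m) v) z (W ∘ map (rot (suc m))) ⟩
      z * sumℤ (map (W ∘ map (rot (suc m))) (Ending (suc m) v))
        ≡⟨ cong (z *_) (sym reindexed) ⟩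
      z * S (suc v) ∎
      where
      v≢n : v ≢ suc m
      v≢n v≡n = ℕ.<-irrefl v≡n v<n
      not-top : ∀ {π} → π ∈ Ending (suc m) v → last π ≢ just (suc m)
      not-top π∈ last≡n = v≢n (just-injective (trans (sym (proj₂ (∈-Ending⁻ (suc m) v π∈))) last≡n))
      bounded-of : ∀ {π} w → π ∈ Ending (suc m) w → Bounded (suc m) π
      bounded-of w = IsArc.bounded ∘ proj₁ ∘ ∈-Ending⁻ (suc m) w
      into : ∀ {π} → π ∈ Ending (suc m) v → map (rot (suc m)) π ∈ Ending (suc m) (suc v)
      into {π} π∈ = let arc , last≡ = ∈-Ending⁻ (suc m) v π∈ in
        ∈-Ending⁺ (arc-rot arc) (trans (last-map-just (rot (suc m)) π last≡) (cong just (rot-≢ v≢n)))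
      back : ∀ {w} → 1 ≤ w → rot⁻¹ (suc m) (suc w) ≡ w
      back (s≤s z≤n) = refl
      onto : ∀ {σ} → σ ∈ Ending (suc m) (suc v) → ∃ λ π → π ∈ Ending (suc m) v × map (rot (suc m)) π ≡ σ
      onto {σ} σ∈ = let arc , last≡ = ∈-Ending⁻ (suc m) (suc v) σ∈ in
        map (rot⁻¹ (suc m)) σ ,
        ∈-Ending⁺ (arc-rot⁻¹ arc) (trans (last-map-just (rot⁻¹ (suc m)) σ last≡) (cong just (back 1≤v))) ,
        Relabel.map-bwd-fwd (inverse (rotation (suc m))) (IsArc.bounded arc)
      reindexed : S (suc v) ≡ sumℤ (map (W ∘ map (rot (suc m))) (Ending (suc m) v))
      reindexed = sumℤ-reindex (Ending (suc m) v) (Ending (suc m) (suc v)) (map (rot (suc m))) W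
        (Ending-unique (suc m) v) (Ending-unique (suc m) (suc v))
        (λ π∈ π′∈ → Relabel.map-fwd-injective (rotation (suc m)) (bounded-of v π∈) (bounded-of v π′∈))
        into onto

    rotation-chain : ∀ i → i < suc m → S (suc m ∸ i) ≡ z ^ i * S (suc m)
    rotation-chain zero    _   = sym (ℤ.*-identityˡ (S (suc m)))
    rotation-chain (suc i) i<n = begin
      S (suc m ∸ suc i)          ≡⟨ rotation-step (ℕ.m<n⇒0<n∸m i<n) (ℕ.∸-monoʳ-< (s≤s z≤n) (ℕ.<⇒≤ i<n)) ⟩
      z * S (suc (suc m ∸ suc i)) ≡⟨ cong (λ v → z * S v) (sym (ℕ.+-∸-assoc 1 (ℕ.<⇒≤ i<n))) ⟩
      z * S (suc m ∸ i)          ≡⟨ cong (z *_) (rotation-chain i (ℕ.<-trans (ℕ.n<1+n i) i<n)) ⟩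
      z * (z ^ i * S (suc m))    ≡⟨ sym (ℤ.*-assoc z (z ^ i) (S (suc m))) ⟩
      z ^ suc i * S (suc m)      ∎

    last-letters : List (Maybe ℕ)
    last-letters = map (λ i → just (suc m ∸ i)) (upTo (suc m))

    last-letters-unique : Unique last-letters
    last-letters-unique = map-unique-on (λ i → just (suc m ∸ i)) distinct (Unique.upTo⁺ (suc m))
      where
      distinct : ∀ {i i′} → i ∈ upTo (suc m) → i′ ∈ upTo (suc m) →
                 just (suc m ∸ i) ≡ just (suc m ∸ i′) → i ≡ i′
      distinct i∈ i′∈ eq = ℕ.∸-cancelˡ-≡ (ℕ.<⇒≤ (below i∈)) (ℕ.<⇒≤ (below i′∈)) (just-injective eq)

    ∈-last-letters : ∀ {π} → π ∈ Arc (suc m) → last π ∈ last-letters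
    ∈-last-letters π∈ with perm-last (IsArc.perm (∈-Arc⁻ π∈))
    ... | v , last≡ , 1≤v , v≤n = subst (_∈ last-letters) (trans (cong just (ℕ.m∸[m∸n]≡n v≤n)) (sym last≡))
      (∈-map⁺ (λ i → just (suc m ∸ i)) (∈-applyUpTo⁺ (λ i → i) (ℕ.∸-monoʳ-< 1≤v v≤n)))

    total-weight : sumℤ (map W (Arc (suc m))) ≡ qint (suc m) z * S (suc m)
    total-weight = begin
      sumℤ (map W (Arc (suc m)))
        ≡⟨ sumℤ-partition _≟ᴹ_ last W (Arc (suc m)) last-letters last-letters-unique ∈-last-letters ⟩
      sumℤ (map (λ u → sumℤ (map W (Part _≟ᴹ_ last (Arc (suc m)) u))) last-letters)
        ≡⟨ cong sumℤ (sym (map-∘ {g = λ u → sumℤ (map W (Part _≟ᴹ_ last (Arc (suc m)) u))}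
                                  {f = λ i → just (suc m ∸ i)} (upTo (suc m)))) ⟩
      sumℤ (map (λ i → S (suc m ∸ i)) (upTo (suc m)))
        ≡⟨ sumℤ-cong (upTo (suc m)) (λ i∈ → rotation-chain _ (below i∈)) ⟩
      sumℤ (map (λ i → z ^ i * S (suc m)) (upTo (suc m)))
        ≡⟨ sumℤ-scaleʳ (upTo (suc m)) (S (suc m)) (z ^_) ⟩
      sumℤ (map (z ^_) (upTo (suc m))) * S (suc m)
        ≡⟨ cong (λ l → sumℤ l * S (suc m)) (map-upTo (z ^_) (suc m)) ⟩
      qint (suc m) z * S (suc m) ∎

  product-++ : ∀ xs ys → foldr _*_ (+ 1) (xs ++ ys) ≡ foldr _*_ (+ 1) xs * foldr _*_ (+ 1) ys
  product-++ []       ys = sym (ℤ.*-identityˡ _)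
  product-++ (x ∷ xs) ys = trans (cong (x *_) (product-++ xs ys)) (sym (ℤ.*-assoc x _ _))

  prodFrom1-suc : ∀ k f → prodFrom1 (suc k) f ≡ prodFrom1 k f * f (suc k)
  prodFrom1-suc k f = begin
    foldr _*_ (+ 1) (map f (range 1 (suc k)))
      ≡⟨ cong (foldr _*_ (+ 1) ∘ map f) (sym (applyUpTo-∷ʳ (1 ℕ.+_) k)) ⟩
    foldr _*_ (+ 1) (map f (range 1 k ++ [ suc k ]))
      ≡⟨ cong (foldr _*_ (+ 1)) (map-++ f (range 1 k) [ suc k ]) ⟩
    foldr _*_ (+ 1) (map f (range 1 k) ++ [ f (suc k) ])
      ≡⟨ product-++ (map f (range 1 k)) [ f (suc k) ] ⟩
    prodFrom1 k f * (f (suc k) * + 1)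
      ≡⟨ cong (prodFrom1 k f *_) (ℤ.*-identityʳ (f (suc k))) ⟩
    prodFrom1 k f * f (suc k) ∎

  sumℤ-codes : ∀ (w : List Bool → ℤ) (t : ℕ → ℤ) → w [] ≡ + 1 →
               (∀ c → w (true ∷ c) ≡ w c) → (∀ c → w (false ∷ c) ≡ w c * t (suc (length c))) →
               ∀ k → sumℤ (map w (bools k)) ≡ prodFrom1 k (λ i → + 1 + t i)
  sumℤ-codes w t w[] w-true w-false zero    = cong (_+ + 0) w[]
  sumℤ-codes w t w[] w-true w-false (suc k) = begin
    sumℤ (map w (map (true ∷_) B ++ map (false ∷_) B))
      ≡⟨ cong sumℤ (map-++ w (map (true ∷_) B) (map (false ∷_) B)) ⟩
    sumℤ (map w (map (true ∷_) B) ++ map w (map (false ∷_) B))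
      ≡⟨ sumℤ-++ (map w (map (true ∷_) B)) _ ⟩
    sumℤ (map w (map (true ∷_) B)) + sumℤ (map w (map (false ∷_) B))
      ≡⟨ cong₂ _+_ (cong sumℤ (sym (map-∘ B))) (cong sumℤ (sym (map-∘ B))) ⟩
    sumℤ (map (λ c → w (true ∷ c)) B) + sumℤ (map (λ c → w (false ∷ c)) B)
      ≡⟨ cong₂ _+_ (sumℤ-cong B (λ {c} _ → w-true c))
                   (sumℤ-cong B (λ {c} c∈ → trans (w-false c) (cong (λ l → w c * t (suc l)) (∈-bools⁻ k c∈)))) ⟩
    P + sumℤ (map (λ c → w c * t (suc k)) B)
      ≡⟨ cong (_+_ P) (sumℤ-scaleʳ B (t (suc k)) w) ⟩
    P + P * t (suc k)
      ≡⟨ cong (_+ P * t (suc k)) (sym (ℤ.*-identityʳ P)) ⟩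
    P * + 1 + P * t (suc k)
      ≡⟨ sym (ℤ.*-distribˡ-+ P (+ 1) (t (suc k))) ⟩
    P * (+ 1 + t (suc k))
      ≡⟨ cong (_* (+ 1 + t (suc k))) (sumℤ-codes w t w[] w-true w-false k) ⟩
    prodFrom1 k (λ i → + 1 + t i) * (+ 1 + t (suc k))
      ≡⟨ sym (prodFrom1-suc k (λ i → + 1 + t i)) ⟩
    prodFrom1 (suc k) (λ i → + 1 + t i) ∎
    where
    B : List (List Bool)
    B = bools k
    P : ℤ
    P = sumℤ (map w B)

  sumℤ-Ending-top : ∀ k (W : List ℕ → ℤ) →
    sumℤ (map W (Ending (suc (suc k)) (suc (suc k)))) ≡ sumℤ (map (λ c → W (lin c ++ [ suc (suc k) ])) (bools k))
  sumℤ-Ending-top k W = sumℤ-reindex (bools k) (Ending n n) (λ c → lin c ++ [ n ]) W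
    (bools-unique k) (Ending-unique n n)
    (λ {c} {c′} _ _ eq → lin-injective c c′ (∷ʳ-injectiveˡ (lin c) (lin c′) eq))
    (λ {c} c∈ → ∈-Ending⁺ (lin-arc c∈) (last-∷ʳ (lin c) n))
    (λ π∈ → let arc , last≡ = ∈-Ending⁻ n n π∈ in arc⇒lin arc last≡)
    where
    n : ℕ
    n = suc (suc k)

  maj-weight signed-weight : ℤ → List ℕ → ℤ
  maj-weight    q π = q ^ maj π
  signed-weight q π = sign π * q ^ maj π

  maj-weight-rot : ∀ {m π} q → IsPerm (suc m) π → last π ≢ just (suc m) →
    q * maj-weight q (map (rot (suc m)) π) ≡ maj-weight q π
  maj-weight-rot q perm last≢n = cong (q ^_) (trans (ℕ.+-comm 1 _) (maj-perm-rot perm last≢n))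

  minus-one : ℤ
  minus-one = - (+ 1)

  minus-one-even : ∀ a → minus-one ^ (a ℕ.+ a) ≡ + 1
  minus-one-even zero    = refl
  minus-one-even (suc a) rewrite ℕ.+-suc a a | minus-one-even a = refl

  minus-one-power : ∀ s q → minus-one ^ s * q ^ s ≡ (- q) ^ s
  minus-one-power zero    q = refl
  minus-one-power (suc s) q = begin
    (minus-one * minus-one ^ s) * (q * q ^ s) ≡⟨ interchange minus-one (minus-one ^ s) q (q ^ s) ⟩
    (minus-one * q) * (minus-one ^ s * q ^ s) ≡⟨ cong₂ _*_ (ℤ.-1*i≡-i q) (minus-one-power s q) ⟩
    (- q) * (- q) ^ s                         ∎

  sign-rot : ∀ {m π} → IsPerm (suc m) π → minus-one ^ m * sign (map (rot (suc m)) π) ≡ sign π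
  sign-rot {m} {π} perm with inv-perm-rot perm
  ... | a , parity = begin
    minus-one ^ m * minus-one ^ inv ρπ       ≡⟨ sym (ℤ.^-distribˡ-+-* minus-one m (inv ρπ)) ⟩
    minus-one ^ (m ℕ.+ inv ρπ)               ≡⟨ cong (minus-one ^_) (trans (ℕ.+-comm m (inv ρπ)) parity) ⟩
    minus-one ^ (inv π ℕ.+ (a ℕ.+ a))        ≡⟨ ℤ.^-distribˡ-+-* minus-one (inv π) (a ℕ.+ a) ⟩
    minus-one ^ inv π * minus-one ^ (a ℕ.+ a) ≡⟨ cong (minus-one ^ inv π *_) (minus-one-even a) ⟩
    minus-one ^ inv π * + 1                  ≡⟨ ℤ.*-identityʳ _ ⟩
    minus-one ^ inv π                        ∎
    where
    ρπ : List ℕ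
    ρπ = map (rot (suc m)) π

  signed-weight-rot : ∀ {m π} q → IsPerm (suc m) π → last π ≢ just (suc m) →
    (minus-one ^ m * q) * signed-weight q (map (rot (suc m)) π) ≡ signed-weight q π
  signed-weight-rot {m} {π} q perm last≢n = trans
    (interchange (minus-one ^ m) q (sign (map (rot (suc m)) π)) (q ^ maj (map (rot (suc m)) π)))
    (cong₂ _*_ (sign-rot perm) (maj-weight-rot q perm last≢n))

  signed-weight-false : ∀ q c → signed-weight q (lin (false ∷ c)) ≡ signed-weight q (lin c) * (- q) ^ suc (length c)
  signed-weight-false q c = begin
    minus-one ^ inv (lin (false ∷ c)) * q ^ maj (lin (false ∷ c))
      ≡⟨ cong₂ (λ i j → minus-one ^ i * q ^ j) (inv-lin-false c) (maj-lin-false c) ⟩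
    minus-one ^ (inv (lin c) ℕ.+ s) * q ^ (maj (lin c) ℕ.+ s)
      ≡⟨ cong₂ _*_ (ℤ.^-distribˡ-+-* minus-one (inv (lin c)) s) (ℤ.^-distribˡ-+-* q (maj (lin c)) s) ⟩
    (minus-one ^ inv (lin c) * minus-one ^ s) * (q ^ maj (lin c) * q ^ s)
      ≡⟨ interchange (minus-one ^ inv (lin c)) (minus-one ^ s) (q ^ maj (lin c)) (q ^ s) ⟩
    signed-weight q (lin c) * (minus-one ^ s * q ^ s)
      ≡⟨ cong (signed-weight q (lin c) *_) (minus-one-power s q) ⟩
    signed-weight q (lin c) * (- q) ^ s ∎
    where
    s : ℕ
    s = suc (length c)

  maj-generating-function : ∀ k q →
    sumℤ (map (λ π → q ^ maj π) (Arc (suc (suc k)))) ≡ qint (suc (suc k)) q * prodFrom1 k (λ i → + 1 + q ^ i)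
  maj-generating-function k q = begin
    sumℤ (map (maj-weight q) (Arc n))
      ≡⟨ total-weight ⟩
    qint n q * S n
      ≡⟨ cong (qint n q *_) (sumℤ-Ending-top k (maj-weight q)) ⟩
    qint n q * sumℤ (map (λ c → q ^ maj (lin c ++ [ n ])) (bools k))
      ≡⟨ cong (qint n q *_) (sumℤ-cong (bools k) (cong (q ^_) ∘ maj-lin-top)) ⟩
    qint n q * sumℤ (map (λ c → q ^ maj (lin c)) (bools k))
      ≡⟨ cong (qint n q *_) (sumℤ-codes _ (q ^_) refl (cong (q ^_) ∘ maj-lin-true) false-step k) ⟩
    qint n q * prodFrom1 k (λ i → + 1 + q ^ i) ∎
    where
    n : ℕ
    n = suc (suc k)
    open RotationChain (suc k) (maj-weight q) q (maj-weight-rot q ∘ IsArc.perm)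
    false-step : ∀ c → q ^ maj (lin (false ∷ c)) ≡ q ^ maj (lin c) * q ^ suc (length c)
    false-step c = trans (cong (q ^_) (maj-lin-false c)) (ℤ.^-distribˡ-+-* q (maj (lin c)) (suc (length c)))

  signed-maj-generating-function : ∀ k q →
    sumℤ (map (λ π → sign π * q ^ maj π) (Arc (suc (suc k))))
      ≡ qint (suc (suc k)) (minus-one ^ suc k * q) * prodFrom1 k (λ i → + 1 + (- q) ^ i)
  signed-maj-generating-function k q = begin
    sumℤ (map (signed-weight q) (Arc n))
      ≡⟨ total-weight ⟩
    qint n z * S n
      ≡⟨ cong (qint n z *_) (sumℤ-Ending-top k (signed-weight q)) ⟩
    qint n z * sumℤ (map (λ c → signed-weight q (lin c ++ [ n ])) (bools k))
      ≡⟨ cong (qint n z *_) (sumℤ-cong (bools k)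
           (λ c∈ → cong₂ (λ i j → minus-one ^ i * q ^ j) (inv-lin-top c∈) (maj-lin-top c∈))) ⟩
    qint n z * sumℤ (map (signed-weight q ∘ lin) (bools k))
      ≡⟨ cong (qint n z *_) (sumℤ-codes _ ((- q) ^_) refl true-step (signed-weight-false q) k) ⟩
    qint n z * prodFrom1 k (λ i → + 1 + (- q) ^ i) ∎
    where
    n : ℕ
    n = suc (suc k)
    z : ℤ
    z = minus-one ^ suc k * q
    open RotationChain (suc k) (signed-weight q) z (signed-weight-rot q ∘ IsArc.perm)
    true-step : ∀ c → signed-weight q (lin (true ∷ c)) ≡ signed-weight q (lin c)
    true-step c = cong₂ (λ i j → minus-one ^ i * q ^ j) (inv-lin-true c) (maj-lin-true c)


open import Defs
open import Data.Nat using (ℕ; _≤_; _∸_; zero; suc; s≤s)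
open import Data.Integer using (ℤ; +_; -_; _+_; _*_; _^_)
open import Data.List using (map)
open import Data.Product using (_×_; _,_)
open import Relation.Binary.PropositionalEquality using (_≡_)
open GeneratingFunctions using (maj-generating-function; signed-maj-generating-function)

theorem2p6 : (n : ℕ) → 2 ≤ n → (q : ℤ) →
    (sumℤ (map (λ π → q ^ maj π) (Arc n))
       ≡ qint n q * prodFrom1 (n ∸ 2) (λ i → + 1 + q ^ i))
    × (sumℤ (map (λ π → sign π * q ^ maj π) (Arc n))
       ≡ qint n (((- (+ 1)) ^ (n ∸ 1)) * q) * prodFrom1 (n ∸ 2) (λ i → + 1 + (- q) ^ i))
theorem2p6 (suc (suc k)) _ q = maj-generating-function k q , signed-maj-generating-function k q
theorem2p6 (suc zero)    (s≤s ()) _
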